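{- The numbers $a_{n,t,s}$ can be non-zero only when $n\ge 2$ and $1\le s<t\le n$. They satisfy $$a_{n,t,s}=\sum_{j=t}^{n-1}a_{n-1,j,s}+\sum_{r=1}^{t-s}\sum_{i=1}^{s-1}a_{n-r,t-r,i},\qquad n\ge3,\ 2\le s<t\le n,$$ and $$a_{n,t,1}=2^{n-t},\qquad n\ge 2,\ 2\le t\le n.$$
   Context: A restricted growth function (RGF) of length $n$ is a sequence $\pi=\pi_1\cdots\pi_n$ of positive integers with $\pi_1=1$ and $\pi_{i+1}\le\max\{\pi_1,\dots,\pi_i\}+1$ for all $i\in[n-1]$; these are exactly the canonical sequential forms of set partitions of $[n]=\{1,\dots,n\}$ (with $j$ in block $\pi_j$, blocks ordered by their minima). A sequence $\pi$ contains the pattern $12123$ if there are indices $f(1)<\cdots<f(5)$ such that $(\pi_{f(1)},\dots,\pi_{f(5)})$ is order-isomorphic to $(1,2,1,2,3)$, i.e. $\pi_{f(1)}=\pi_{f(3)}<\pi_{f(2)}=\pi_{f(4)}<\pi_{f(5)}$; otherwise it avoids $12123$. For $n\ge 2$ and $1\le s<t\le n$, $A_{n,t,s}$ is the set of RGFs of length $n$ avoiding $12123$, having at least two distinct letters, in which the left-most occurrence of the largest letter is at position $t$ and the left-most occurrence of the second largest letter is at position $s$; $a_{n,t,s}=|A_{n,t,s}|$ (taken to be $0$ for other indices). -}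

module Defs where

open import Data.Nat using (ℕ; zero; suc; _+_; _∸_; _⊔_; _≡ᵇ_; _<ᵇ_; _≤ᵇ_)
open import Data.Bool using (Bool; true; false; _∧_; if_then_else_)
open import Data.List using (List; []; _∷_; map; _++_; concatMap; filter; length; upTo; foldr)
open import Data.Nat.ListAction using (sum)
open import Relation.Nullary.Decidable using (Dec)
open import Data.Bool.Properties using (T?)

-- Sequences are lists of natural numbers; positions are 1-indexed.

words : ℕ → ℕ → List (List ℕ)
words zero    k = [] ∷ []
words (suc n) k = concatMap (λ x → map (x ∷_) (words n k)) (map suc (upTo k))

maxL : List ℕ → ℕ
maxL = foldr _⊔_ 0

secondMax : List ℕ → ℕ
secondMax π = foldr (λ x acc → if x <ᵇ maxL π then x ⊔ acc else acc) 0 π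

-- 1-indexed position of the left-most occurrence of v in the list (0 if absent)
firstOcc : ℕ → List ℕ → ℕ
firstOcc v [] = 0
firstOcc v (x ∷ xs) = if x ≡ᵇ v then 1 else (if firstOcc v xs ≡ᵇ 0 then 0 else suc (firstOcc v xs))

rgfFrom : ℕ → List ℕ → Bool
rgfFrom m [] = true
rgfFrom m (x ∷ xs) = (1 ≤ᵇ x) ∧ (x ≤ᵇ suc m) ∧ rgfFrom (m ⊔ x) xs

isRGF : List ℕ → Bool
isRGF [] = true
isRGF (x ∷ xs) = (x ≡ᵇ 1) ∧ rgfFrom 1 xs

choose : {A : Set} → ℕ → List A → List (List A)
choose zero    xs       = [] ∷ []
choose (suc k) []       = []
choose (suc k) (x ∷ xs) = map (x ∷_) (choose k xs) ++ choose (suc k) xs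

is12123 : List ℕ → Bool
is12123 (a ∷ b ∷ c ∷ d ∷ e ∷ []) = (a ≡ᵇ c) ∧ (b ≡ᵇ d) ∧ (a <ᵇ b) ∧ (b <ᵇ e)
is12123 _ = false

any : {A : Set} → (A → Bool) → List A → Bool
any p = foldr (λ x acc → if p x then true else acc) false

contains12123 : List ℕ → Bool
contains12123 π = any is12123 (choose 5 π)

not : Bool → Bool
not true = false
not false = true

-- membership test for A_{n,t,s} (π ranges over words of length n)
inA : ℕ → ℕ → List ℕ → Bool
inA t s π = isRGF π ∧ not (contains12123 π) ∧ (2 ≤ᵇ maxL π)
            ∧ (firstOcc (maxL π) π ≡ᵇ t) ∧ (firstOcc (secondMax π) π ≡ᵇ s)

-- a_{n,t,s} = |A_{n,t,s}|; every RGF of length n has letters in {1..n}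
a : ℕ → ℕ → ℕ → ℕ
a n t s = length (filter (λ π → T? (inA t s π)) (words n n))

-- Σ_{i=lo}^{hi} f i  (empty when hi < lo)
sumFT : ℕ → ℕ → (ℕ → ℕ) → ℕ
sumFT lo hi f = sum (map (λ i → f (lo + i)) (upTo (suc hi ∸ lo)))

-- A member π of A_{n,t,s} has the form u c v (c+1) y, where c + 1 and c are its two largest letters,
-- u contains neither of them, v does not contain c + 1, s = |u| + 1 and t = |u| + |v| + 2; conversely
-- every 12123-avoiding RGF of this form lies in A_{n,t,s}. For s = 1 the form forces π = 1^(t-1) 2 y
-- with y an arbitrary word over {1,2}, which gives 2^(n-t). For s ≥ 2 we split according to whether
-- c + 1 occurs again. If it does, deleting its first occurrence is a bijection onto A_{n-1,j,s}, where
-- j is the new position of its second occurrence. If it does not, write v = c^(r-1) δ with δ not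
-- starting with c; avoidance of 12123 forces c ∉ δ, and deleting the run c^r at s while lowering
-- c + 1 to c is a bijection onto A_{n-r,t-r,i}, where i is the first position of c - 1.

module Submission where

open import Defs
open import Data.Bool using (Bool; true; false; _∧_; T; if_then_else_)
open import Data.Bool.Properties using (T?; T-≡; T-∧)
open import Data.Empty using (⊥-elim)
open import Data.List
  using (List; []; _∷_; map; _++_; concatMap; cartesianProductWith; filter; length; upTo; applyUpTo; foldr; replicate; take; drop)
open import Data.List.Membership.Propositional using (_∈_; _∉_; find; lose)
open import Data.List.Membership.Propositional.Properties
  using ( ∈-upTo⁻; ∈-upTo⁺; ∈-cartesianProductWith⁺; ∈-cartesianProductWith⁻; ∈-filter⁺; ∈-filter⁻
        ; ∈-∃++; ∈-++⁻; ∈-++⁺ˡ; ∈-++⁺ʳ; ∈-map⁻; ∈-map⁺)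
open import Data.List.Properties
  using ( ∷-injective; length-replicate; length-++; length-upTo; length-map; map-applyUpTo; map-upTo; map-cong
        ; map-cong-local; ++-assoc; filter-accept; filter-reject; filter-none; filter-all)
open import Data.List.Relation.Binary.Sublist.Propositional using (_⊆_; []; _∷_; _∷ʳ_; ⊆-refl; ⊆-trans; minimum; from∈; to∈)
open import Data.List.Relation.Binary.Sublist.Propositional.Properties using (++⁺; ++⁺ˡ; ∷ˡ⁻; All-resp-⊆)
open import Data.List.Relation.Unary.All as All using (All; []; _∷_)
import Data.List.Relation.Unary.All.Properties as All
open import Data.List.Relation.Unary.AllPairs using ([]; _∷_)
open import Data.List.Relation.Unary.Any using (here; there; any?)
open import Data.List.Relation.Unary.Unique.Propositional using (Unique)
import Data.List.Relation.Unary.Unique.Propositional.Properties as Unique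
open import Data.Nat using (ℕ; zero; suc; _+_; _*_; _∸_; _^_; _≤_; _<_; _⊔_; _≡ᵇ_; _<ᵇ_; _≤ᵇ_; z≤n; s≤s; _≟_)
open import Data.Nat.ListAction using (sum)
open import Data.List.Membership.DecPropositional _≟_ using (_∈?_)
open import Data.Nat.Properties
open import Data.Nat.Tactic.RingSolver using (solve-∀)
open import Data.Product using (_×_; _,_; proj₁; proj₂; ∃-syntax)
open import Data.Sum using (_⊎_; inj₁; inj₂; [_,_]′)
open import Data.Unit using (⊤)
open import Function using (_⇔_; _∘_; Equivalence; mk⇔)
open import Level using (Level)
open import Relation.Binary.PropositionalEquality
  using (_≡_; _≢_; refl; sym; trans; cong; cong₂; subst; subst₂; module ≡-Reasoning)
open import Relation.Nullary using (¬_; Dec; yes; no; contradiction)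
open import Relation.Unary using (Pred; Decidable; U)
open import Relation.Unary.Properties using (_∩?_; ∁?; U?)

private
  variable
    ℓ ℓ′ : Level
    A B : Set

≡ᵇ-refl : ∀ m → (m ≡ᵇ m) ≡ true
≡ᵇ-refl zero = refl
≡ᵇ-refl (suc m) = ≡ᵇ-refl m

≢⇒≡ᵇ-false : ∀ {m n} → m ≢ n → (m ≡ᵇ n) ≡ false
≢⇒≡ᵇ-false {m} {n} m≢n with m ≡ᵇ n in eq
... | true = contradiction (≡ᵇ⇒≡ m n (subst T (sym eq) _)) m≢n
... | false = refl

T-∧⁻ : ∀ {b b′} → T (b ∧ b′) → T b × T b′
T-∧⁻ {b} = Equivalence.to (T-∧ {b})

T-∧⁺ : ∀ {b b′} → T b → T b′ → T (b ∧ b′)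
T-∧⁺ {b} tb tb′ = Equivalence.from (T-∧ {b}) (tb , tb′)

T-not⁻ : ∀ {b} → T (not b) → ¬ T b
T-not⁻ {false} _ ()

T-not⁺ : ∀ {b} → ¬ T b → T (not b)
T-not⁺ {true} ¬b = ¬b _
T-not⁺ {false} _ = _

2≤⇒≡suc : ∀ {n} → 2 ≤ n → ∃[ c ] n ≡ suc c × 1 ≤ c
2≤⇒≡suc (s≤s (s≤s {n = k} z≤n)) = suc k , refl , s≤s z≤n

<∸⇒≤ : ∀ {i m n} → i < n ∸ m → m ≤ n
<∸⇒≤ {i} {m} {n} i<n∸m = <⇒≤ (m∸n≢0⇒n<m (λ n∸m≡0 → <⇒≱ i<n∸m (subst (_≤ i) (sym n∸m≡0) z≤n)))

<∸⇒+< : ∀ {i m n} → i < n ∸ m → m + i < n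
<∸⇒+< {i} {m} {n} i<n∸m = begin-strict
  m + i        <⟨ +-monoʳ-< m i<n∸m ⟩
  m + (n ∸ m)  ≡⟨ m+[n∸m]≡n (<∸⇒≤ {i} {m} i<n∸m) ⟩
  n            ∎
  where open ≤-Reasoning

≤∸⇒≤∸ : ∀ {r s t} → 1 ≤ r → r ≤ t ∸ s → s ≤ t ∸ r
≤∸⇒≤∸ {r} {s} {t} 1≤r r≤t∸s =
  m+n≤o⇒m≤o∸n s (subst (_≤ t) (+-comm r s) (m≤o∸n⇒m+n≤o r (<∸⇒≤ {0} {s} (≤-trans 1≤r r≤t∸s)) r≤t∸s))

∉-++⁺ : ∀ {v : A} xs {ys} → v ∉ xs → v ∉ ys → v ∉ xs ++ ys
∉-++⁺ xs v∉xs v∉ys v∈ with ∈-++⁻ xs v∈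
... | inj₁ v∈xs = v∉xs v∈xs
... | inj₂ v∈ys = v∉ys v∈ys

∉-replicate : ∀ {x c : ℕ} r → x ≢ c → x ∉ replicate r c
∉-replicate (suc r) x≢c (here x≡c) = x≢c x≡c
∉-replicate (suc r) x≢c (there x∈) = ∉-replicate r x≢c x∈

All<⇒∉ : ∀ {c xs} → All (_< c) xs → c ∉ xs
All<⇒∉ <c c∈ = <-irrefl refl (All.lookup <c c∈)

All≤⇒∉suc : ∀ {m xs} → All (_≤ m) xs → suc m ∉ xs
All≤⇒∉suc xs≤m = All<⇒∉ (All.map s≤s xs≤m)

All≤∧∉⇒All< : ∀ {m xs} → All (_≤ m) xs → m ∉ xs → All (_< m) xs
All≤∧∉⇒All< [] _ = []
All≤∧∉⇒All< (x≤ ∷ xs≤) m∉ with m≤n⇒m<n∨m≡n x≤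
... | inj₁ x<m = x<m ∷ All≤∧∉⇒All< xs≤ (m∉ ∘ there)
... | inj₂ refl = contradiction (here refl) m∉

All≤suc⇒All≤ : ∀ {c xs} → All (_≤ suc c) xs → suc c ∉ xs → All (_≤ c) xs
All≤suc⇒All≤ xs≤ c+1∉ = All.map ≤-pred (All≤∧∉⇒All< xs≤ c+1∉)

All≡⇒replicate : ∀ {x : A} xs → All (_≡ x) xs → xs ≡ replicate (length xs) x
All≡⇒replicate [] [] = refl
All≡⇒replicate (y ∷ xs) (refl ∷ xs≡) = cong (y ∷_) (All≡⇒replicate xs xs≡)

remove-∈ : ∀ {x z : A} ys zs → z ∈ ys ++ x ∷ zs → z ≢ x → z ∈ ys ++ zs
remove-∈ [] zs (here z≡x) z≢x = contradiction z≡x z≢x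
remove-∈ [] zs (there z∈) z≢x = z∈
remove-∈ (y ∷ ys) zs (here z≡y) z≢x = here z≡y
remove-∈ (y ∷ ys) zs (there z∈) z≢x = there (remove-∈ ys zs z∈ z≢x)

take-++-length : ∀ (xs ys : List A) {k} → length xs ≡ k → take k (xs ++ ys) ≡ xs
take-++-length [] ys refl = refl
take-++-length (x ∷ xs) ys refl = cong (x ∷_) (take-++-length xs ys refl)

drop-++-length : ∀ (xs ys : List A) {k} → length xs ≡ k → drop k (xs ++ ys) ≡ ys
drop-++-length [] ys refl = refl
drop-++-length (x ∷ xs) ys refl = drop-++-length xs ys refl

drop-++-∷ : ∀ (xs : List A) {m ys k} → length xs ≡ k → drop (suc k) (xs ++ m ∷ ys) ≡ ys
drop-++-∷ [] refl = refl
drop-++-∷ (x ∷ xs) refl = drop-++-∷ xs refl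

length-++-∷ : ∀ (xs : List A) {m ys} → length (xs ++ m ∷ ys) ≡ suc (length (xs ++ ys))
length-++-∷ xs {m} {ys} = begin
  length (xs ++ m ∷ ys)          ≡⟨ length-++ xs ⟩
  length xs + suc (length ys)    ≡⟨ +-suc (length xs) (length ys) ⟩
  suc (length xs + length ys)    ≡⟨ cong suc (length-++ xs) ⟨
  suc (length (xs ++ ys))        ∎
  where open ≡-Reasoning

splitAt-length : ∀ k (v : List A) → k ≤ length v → ∃[ v₁ ] ∃[ v₂ ] v ≡ v₁ ++ v₂ × length v₁ ≡ k
splitAt-length zero v _ = [] , v , refl , refl
splitAt-length (suc k) (x ∷ v) (s≤s k≤) =
  let (v₁ , v₂ , v≡ , |v₁|≡) = splitAt-length k v k≤ in x ∷ v₁ , v₂ , cong (x ∷_) v≡ , cong suc |v₁|≡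

count : {P : Pred A ℓ} → Decidable P → List A → ℕ
count P? xs = length (filter P? xs)

module _ {P : Pred A ℓ} (P? : Decidable P) where

  count-accept : ∀ {x} xs → P x → count P? (x ∷ xs) ≡ suc (count P? xs)
  count-accept xs px = cong length (filter-accept P? {xs = xs} px)

  count-reject : ∀ {x} xs → ¬ P x → count P? (x ∷ xs) ≡ count P? xs
  count-reject xs ¬px = cong length (filter-reject P? {xs = xs} ¬px)

  count-none : ∀ {xs} → (∀ {x} → x ∈ xs → ¬ P x) → count P? xs ≡ 0
  count-none none = cong length (filter-none P? (All.tabulate none))

  count-all : ∀ {xs} → (∀ {x} → x ∈ xs → P x) → count P? xs ≡ length xs
  count-all all = cong length (filter-all P? (All.tabulate all))

module _ {P : Pred A ℓ} {Q : Pred A ℓ′} (P? : Decidable P) (Q? : Decidable Q) where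
  open ≡-Reasoning

  count-cong : ∀ xs → (∀ {x} → x ∈ xs → P x ⇔ Q x) → count P? xs ≡ count Q? xs
  count-cong [] _ = refl
  count-cong (x ∷ xs) P⇔Q = by-cases (P? x)
    where
    by-cases : Dec (P x) → count P? (x ∷ xs) ≡ count Q? (x ∷ xs)
    by-cases (yes px) = begin
      count P? (x ∷ xs)  ≡⟨ count-accept P? xs px ⟩
      suc (count P? xs)  ≡⟨ cong suc (count-cong xs (P⇔Q ∘ there)) ⟩
      suc (count Q? xs)  ≡⟨ count-accept Q? xs (Equivalence.to (P⇔Q (here refl)) px) ⟨
      count Q? (x ∷ xs)  ∎
    by-cases (no ¬px) = begin
      count P? (x ∷ xs)  ≡⟨ count-reject P? xs ¬px ⟩
      count P? xs        ≡⟨ count-cong xs (P⇔Q ∘ there) ⟩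
      count Q? xs        ≡⟨ count-reject Q? xs (¬px ∘ Equivalence.from (P⇔Q (here refl))) ⟨
      count Q? (x ∷ xs)  ∎

  count-split : ∀ xs → count P? xs ≡ count (P? ∩? ∁? Q?) xs + count (P? ∩? Q?) xs
  count-split [] = refl
  count-split (x ∷ xs) = by-cases (P? x) (Q? x)
    where
    m = count (P? ∩? ∁? Q?) xs
    n = count (P? ∩? Q?) xs
    by-cases : Dec (P x) → Dec (Q x) → count P? (x ∷ xs) ≡ count (P? ∩? ∁? Q?) (x ∷ xs) + count (P? ∩? Q?) (x ∷ xs)
    by-cases (no ¬px) _ = begin
      count P? (x ∷ xs)  ≡⟨ count-reject P? xs ¬px ⟩
      count P? xs        ≡⟨ count-split xs ⟩
      m + n              ≡⟨ cong₂ _+_ (count-reject (P? ∩? ∁? Q?) xs (¬px ∘ proj₁)) (count-reject (P? ∩? Q?) xs (¬px ∘ proj₁)) ⟨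
      _                  ∎
    by-cases (yes px) (no ¬qx) = begin
      count P? (x ∷ xs)  ≡⟨ count-accept P? xs px ⟩
      suc (count P? xs)  ≡⟨ cong suc (count-split xs) ⟩
      suc m + n          ≡⟨ cong₂ _+_ (count-accept (P? ∩? ∁? Q?) xs (px , ¬qx)) (count-reject (P? ∩? Q?) xs (¬qx ∘ proj₂)) ⟨
      _                  ∎
    by-cases (yes px) (yes qx) = begin
      count P? (x ∷ xs)  ≡⟨ count-accept P? xs px ⟩
      suc (count P? xs)  ≡⟨ cong suc (count-split xs) ⟩
      suc (m + n)        ≡⟨ +-suc m n ⟨
      m + suc n          ≡⟨ cong₂ _+_ (count-reject (P? ∩? ∁? Q?) xs (λ pq → proj₂ pq qx)) (count-accept (P? ∩? Q?) xs (px , qx)) ⟨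
      _                  ∎

Unique-length-≤ : ∀ {xs ys : List A} → Unique xs → (∀ {z} → z ∈ xs → z ∈ ys) → length xs ≤ length ys
Unique-length-≤ [] _ = z≤n
Unique-length-≤ {xs = x ∷ xs} (x≢xs ∷ u) xs⊆ys with ∈-∃++ (xs⊆ys (here refl))
... | ys₁ , ys₂ , refl = begin
  suc (length xs)           ≤⟨ s≤s (Unique-length-≤ u xs⊆ys₁++ys₂) ⟩
  suc (length (ys₁ ++ ys₂)) ≡⟨ cong suc (length-++ ys₁) ⟩
  suc (length ys₁ + length ys₂) ≡⟨ +-suc (length ys₁) (length ys₂) ⟨
  length ys₁ + suc (length ys₂) ≡⟨ length-++ ys₁ ⟨
  length (ys₁ ++ x ∷ ys₂)   ∎
  where
  open ≤-Reasoning
  xs⊆ys₁++ys₂ : ∀ {z} → z ∈ xs → z ∈ ys₁ ++ ys₂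
  xs⊆ys₁++ys₂ z∈ = remove-∈ ys₁ ys₂ (xs⊆ys (there z∈)) (All.lookup x≢xs z∈ ∘ sym)

Unique-map⁺ : ∀ {f : A → B} {xs} → Unique xs → (∀ {x y} → x ∈ xs → y ∈ xs → f x ≡ f y → x ≡ y) → Unique (map f xs)
Unique-map⁺ [] _ = []
Unique-map⁺ (x≢xs ∷ u) inj =
  All.map⁺ (All.tabulate (λ y∈ fx≡fy → All.lookup x≢xs y∈ (inj (here refl) (there y∈) fx≡fy)))
  ∷ Unique-map⁺ u (λ x∈ y∈ → inj (there x∈) (there y∈))

module _ {P : Pred A ℓ} {Q : Pred B ℓ′} (P? : Decidable P) (Q? : Decidable Q) where

  count-injection : ∀ {xs ys} → Unique xs → (f : A → B) →
    (∀ {x} → x ∈ xs → P x → f x ∈ ys × Q (f x)) →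
    (∀ {x x′} → x ∈ xs → x′ ∈ xs → P x → P x′ → f x ≡ f x′ → x ≡ x′) →
    count P? xs ≤ count Q? ys
  count-injection {xs} {ys} u f maps inj = begin
    count P? xs                   ≡⟨ length-map f (filter P? xs) ⟨
    length (map f (filter P? xs)) ≤⟨ Unique-length-≤ (Unique-map⁺ (Unique.filter⁺ P? u) inj′) image⊆ ⟩
    count Q? ys                   ∎
    where
    open ≤-Reasoning
    inj′ : ∀ {x x′} → x ∈ filter P? xs → x′ ∈ filter P? xs → f x ≡ f x′ → x ≡ x′
    inj′ x∈ x′∈ = let (x∈xs , px) = ∈-filter⁻ P? x∈ ; (x′∈xs , px′) = ∈-filter⁻ P? x′∈ in inj x∈xs x′∈xs px px′
    image⊆ : ∀ {z} → z ∈ map f (filter P? xs) → z ∈ filter Q? ys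
    image⊆ z∈ with ∈-map⁻ f z∈
    ... | x , x∈ , refl = let (x∈xs , px) = ∈-filter⁻ P? x∈ ; (fx∈ , qfx) = maps x∈xs px in ∈-filter⁺ Q? fx∈ qfx

count-bijection : {P : Pred A ℓ} {Q : Pred B ℓ′} (P? : Decidable P) (Q? : Decidable Q) → ∀ {xs ys} →
  Unique xs → Unique ys → (f : A → B) (g : B → A) →
  (∀ {x} → x ∈ xs → P x → (f x ∈ ys × Q (f x)) × g (f x) ≡ x) →
  (∀ {y} → y ∈ ys → Q y → (g y ∈ xs × P (g y)) × f (g y) ≡ y) →
  count P? xs ≡ count Q? ys
count-bijection P? Q? uxs uys f g gf fg = ≤-antisym
  (count-injection P? Q? uxs f (λ x∈ px → proj₁ (gf x∈ px)) (cancel f g (λ x∈ px → proj₂ (gf x∈ px))))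
  (count-injection Q? P? uys g (λ y∈ qy → proj₁ (fg y∈ qy)) (cancel g f (λ y∈ qy → proj₂ (fg y∈ qy))))
  where
  cancel : ∀ {a} {A B : Set} {R : Pred A a} {zs} (h : A → B) (k : B → A) →
    (∀ {z} → z ∈ zs → R z → k (h z) ≡ z) →
    ∀ {z z′} → z ∈ zs → z′ ∈ zs → R z → R z′ → h z ≡ h z′ → z ≡ z′
  cancel h k kh z∈ z′∈ rz rz′ hz≡hz′ = trans (sym (kh z∈ rz)) (trans (cong k hz≡hz′) (kh z′∈ rz′))

count≢0⇒∃ : {P : Pred A ℓ} (P? : Decidable P) (xs : List A) → count P? xs ≢ 0 → ∃[ x ] x ∈ xs × P x
count≢0⇒∃ P? xs count≢0 with any? P? xs
... | yes some = find some
... | no none = contradiction (count-none P? (λ x∈ px → none (lose x∈ px))) count≢0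

-- sumFT lo hi = sumFrom lo (suc hi ∸ lo)
sumFrom : ℕ → ℕ → (ℕ → ℕ) → ℕ
sumFrom lo k f = sum (map (λ i → f (lo + i)) (upTo k))

sumFrom-suc : ∀ lo k f → sumFrom lo (suc k) f ≡ f lo + sumFrom (suc lo) k f
sumFrom-suc lo k f = cong₂ _+_ (cong f (+-identityʳ lo)) (cong sum (begin
  map (λ i → f (lo + i)) (applyUpTo suc k)    ≡⟨ map-applyUpTo suc (λ i → f (lo + i)) k ⟩
  applyUpTo (λ i → f (lo + suc i)) k          ≡⟨ map-upTo (λ i → f (lo + suc i)) k ⟨
  map (λ i → f (lo + suc i)) (upTo k)         ≡⟨ map-cong (λ i → cong f (+-suc lo i)) (upTo k) ⟩
  map (λ i → f (suc lo + i)) (upTo k)         ∎))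
  where open ≡-Reasoning

sumFrom-cong : ∀ lo k f g → (∀ i → i < k → f (lo + i) ≡ g (lo + i)) → sumFrom lo k f ≡ sumFrom lo k g
sumFrom-cong lo k f g eq = cong sum (map-cong-local (All.tabulate (λ i∈ → eq _ (∈-upTo⁻ i∈))))

sumFT-cong : ∀ lo hi {f g} → (∀ j → lo ≤ j → j ≤ hi → f j ≡ g j) → sumFT lo hi f ≡ sumFT lo hi g
sumFT-cong lo hi {f} {g} eq = sumFrom-cong lo (suc hi ∸ lo) f g (λ i i< → eq (lo + i) (m≤m+n lo i) (≤-pred (<∸⇒+< i<)))

count-partitionFrom : {P : Pred A ℓ} (P? : Decidable P) (F : A → ℕ) (lo k : ℕ) (xs : List A) →
  (∀ {x} → x ∈ xs → P x → lo ≤ F x × F x < lo + k) →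
  count P? xs ≡ sumFrom lo k (λ j → count (P? ∩? (λ x → F x ≟ j)) xs)
count-partitionFrom P? F lo zero xs range = count-none P? (λ {x} x∈ px →
  let (lo≤Fx , Fx<lo+0) = range x∈ px in <⇒≱ (subst (F x <_) (+-identityʳ lo) Fx<lo+0) lo≤Fx)
count-partitionFrom {P = P} P? F lo (suc k) xs range = begin
  count P? xs                                ≡⟨ count-split P? (λ x → F x ≟ lo) xs ⟩
  count P≢? xs + countAt lo                  ≡⟨ +-comm (count P≢? xs) _ ⟩
  countAt lo + count P≢? xs                  ≡⟨ cong (countAt lo +_) (count-partitionFrom P≢? F (suc lo) k xs range′) ⟩
  countAt lo + sumFrom (suc lo) k countAt≢  ≡⟨ cong (countAt lo +_) (sumFrom-cong (suc lo) k countAt≢ countAt forget-≢) ⟩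
  countAt lo + sumFrom (suc lo) k countAt    ≡⟨ sumFrom-suc lo k countAt ⟨
  sumFrom lo (suc k) countAt                 ∎
  where
  open ≡-Reasoning
  P≢? = P? ∩? ∁? (λ x → F x ≟ lo)
  countAt countAt≢ : ℕ → ℕ
  countAt j = count (P? ∩? (λ x → F x ≟ j)) xs
  countAt≢ j = count (P≢? ∩? (λ x → F x ≟ j)) xs
  range′ : ∀ {x} → x ∈ xs → P x × F x ≢ lo → suc lo ≤ F x × F x < suc lo + k
  range′ {x} x∈ (px , Fx≢lo) = let (lo≤Fx , Fx<) = range x∈ px in
    ≤∧≢⇒< lo≤Fx (Fx≢lo ∘ sym) , subst (F x <_) (+-suc lo k) Fx<
  forget-≢ : ∀ i → i < k → countAt≢ (suc lo + i) ≡ countAt (suc lo + i)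
  forget-≢ i _ = count-cong (P≢? ∩? (λ x → F x ≟ suc lo + i)) (P? ∩? (λ x → F x ≟ suc lo + i)) xs λ _ →
    mk⇔ (λ ((px , _) , Fx≡j) → px , Fx≡j)
        (λ (px , Fx≡j) → (px , λ Fx≡lo → <⇒≢ (s≤s (m≤m+n lo i)) (trans (sym Fx≡lo) Fx≡j)) , Fx≡j)

count-partition : {P : Pred A ℓ} (P? : Decidable P) (F : A → ℕ) (lo hi : ℕ) (xs : List A) →
  (∀ {x} → x ∈ xs → P x → lo ≤ F x × F x ≤ hi) →
  count P? xs ≡ sumFT lo hi (λ j → count (P? ∩? (λ x → F x ≟ j)) xs)
count-partition P? F lo hi xs range = count-partitionFrom P? F lo (suc hi ∸ lo) xs (λ {x} x∈ px →
  let (lo≤Fx , Fx≤hi) = range x∈ px in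
  lo≤Fx , subst (F x <_) (sym (m+[n∸m]≡n (≤-trans lo≤Fx (m≤n⇒m≤1+n Fx≤hi)))) (s≤s Fx≤hi))

concatMap-map≡cartesianProductWith : ∀ {C : Set} (f : A → B → C) xs ys →
  concatMap (λ x → map (f x) ys) xs ≡ cartesianProductWith f xs ys
concatMap-map≡cartesianProductWith f [] ys = refl
concatMap-map≡cartesianProductWith f (x ∷ xs) ys = cong (map (f x) ys ++_) (concatMap-map≡cartesianProductWith f xs ys)

length-cartesianProductWith : ∀ {C : Set} (f : A → B → C) xs ys →
  length (cartesianProductWith f xs ys) ≡ length xs * length ys
length-cartesianProductWith f [] ys = refl
length-cartesianProductWith f (x ∷ xs) ys = begin
  length (map (f x) ys ++ cartesianProductWith f xs ys)  ≡⟨ length-++ (map (f x) ys) ⟩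
  length (map (f x) ys) + length (cartesianProductWith f xs ys)
    ≡⟨ cong₂ _+_ (length-map (f x) ys) (length-cartesianProductWith f xs ys) ⟩
  length ys + length xs * length ys                     ∎
  where open ≡-Reasoning

Letter : ℕ → ℕ → Set
Letter k x = 1 ≤ x × x ≤ k

alphabet : ℕ → List ℕ
alphabet k = map suc (upTo k)

words-suc : ∀ n k → words (suc n) k ≡ cartesianProductWith _∷_ (alphabet k) (words n k)
words-suc n k = concatMap-map≡cartesianProductWith _∷_ (alphabet k) (words n k)

length-words : ∀ n k → length (words n k) ≡ k ^ n
length-words zero k = refl
length-words (suc n) k = begin
  length (words (suc n) k)                                      ≡⟨ cong length (words-suc n k) ⟩
  length (cartesianProductWith _∷_ (alphabet k) (words n k))    ≡⟨ length-cartesianProductWith _∷_ (alphabet k) (words n k) ⟩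
  length (alphabet k) * length (words n k)                      ≡⟨ cong₂ _*_ (trans (length-map suc (upTo k)) (length-upTo k)) (length-words n k) ⟩
  k * k ^ n                                                     ∎
  where open ≡-Reasoning

words-unique : ∀ n k → Unique (words n k)
words-unique zero k = [] ∷ []
words-unique (suc n) k = subst Unique (sym (words-suc n k))
  (Unique.cartesianProductWith⁺ _∷_ ∷-injective (Unique.map⁺ suc-injective (Unique.upTo⁺ k)) (words-unique n k))

∈-words⁺ : ∀ {n k π} → length π ≡ n → All (Letter k) π → π ∈ words n k
∈-words⁺ {zero} {π = []} _ [] = here refl
∈-words⁺ {suc n} {k} {suc x ∷ π} |π|≡ ((_ , x<k) ∷ letters) = subst (_ ∈_) (sym (words-suc n k))
  (∈-cartesianProductWith⁺ _∷_ (∈-map⁺ suc (∈-upTo⁺ x<k)) (∈-words⁺ (suc-injective |π|≡) letters))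

∈-words⁻ : ∀ {n k π} → π ∈ words n k → length π ≡ n × All (Letter k) π
∈-words⁻ {zero} (here refl) = refl , []
∈-words⁻ {suc n} {k} π∈ with ∈-cartesianProductWith⁻ _∷_ (alphabet k) (words n k) (subst (_ ∈_) (words-suc n k) π∈)
... | x , π′ , x∈ , π′∈ , refl with ∈-map⁻ suc x∈ | ∈-words⁻ {n} {k} π′∈
... | i , i∈ , refl | |π′|≡n , letters = cong suc |π′|≡n , (s≤s z≤n , ∈-upTo⁻ i∈) ∷ letters

maxL-lub : ∀ {c} xs → All (_≤ c) xs → maxL xs ≤ c
maxL-lub [] [] = z≤n
maxL-lub (x ∷ xs) (x≤c ∷ xs≤c) = ⊔-lub x≤c (maxL-lub xs xs≤c)

≤-maxL : ∀ {x} xs → x ∈ xs → x ≤ maxL xs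
≤-maxL (y ∷ xs) (here refl) = m≤m⊔n y (maxL xs)
≤-maxL (y ∷ xs) (there x∈) = ≤-trans (≤-maxL xs x∈) (m≤n⊔m y (maxL xs))

All-≤-maxL : ∀ xs → All (_≤ maxL xs) xs
All-≤-maxL xs = All.tabulate (≤-maxL xs)

maxL-≡ : ∀ {m} xs → All (_≤ m) xs → m ∈ xs → maxL xs ≡ m
maxL-≡ xs xs≤m m∈ = ≤-antisym (maxL-lub xs xs≤m) (≤-maxL xs m∈)

maxL-∈ : ∀ xs → 1 ≤ maxL xs → maxL xs ∈ xs
maxL-∈ (x ∷ xs) 1≤max with ≤-total (maxL xs) x
... | inj₁ max≤x = subst (_∈ x ∷ xs) (sym (m≥n⇒m⊔n≡m max≤x)) (here refl)
... | inj₂ x≤max = subst (_∈ x ∷ xs) (sym (m≤n⇒m⊔n≡n x≤max)) (there (maxL-∈ xs (subst (1 ≤_) (m≤n⇒m⊔n≡n x≤max) 1≤max)))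

secondMax-≡ : ∀ π {c} → maxL π ≡ suc c → c ∈ π → secondMax π ≡ c
secondMax-≡ π {c} max≡ c∈ = trans (cong (λ m → largestBelow m π) max≡) (≤-antisym (largestBelow-< π) (≤-largestBelow π c∈))
  where
  largestBelow : ℕ → List ℕ → ℕ
  largestBelow m = foldr (λ x acc → if x <ᵇ m then x ⊔ acc else acc) 0
  largestBelow-< : ∀ xs → largestBelow (suc c) xs ≤ c
  largestBelow-< [] = z≤n
  largestBelow-< (x ∷ xs) with x <ᵇ suc c in eq
  ... | true = ⊔-lub (≤-pred (<ᵇ⇒< x (suc c) (subst T (sym eq) _))) (largestBelow-< xs)
  ... | false = largestBelow-< xs
  ≤-largestBelow : ∀ xs → c ∈ xs → c ≤ largestBelow (suc c) xs
  ≤-largestBelow (x ∷ xs) (here refl) rewrite Equivalence.to T-≡ (<⇒<ᵇ (n<1+n c)) = m≤m⊔n c _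
  ≤-largestBelow (x ∷ xs) (there c∈) with x <ᵇ suc c
  ... | true = ≤-trans (≤-largestBelow xs c∈) (m≤n⊔m x _)
  ... | false = ≤-largestBelow xs c∈

firstOcc-∉ : ∀ {v} xs → v ∉ xs → firstOcc v xs ≡ 0
firstOcc-∉ [] _ = refl
firstOcc-∉ {v} (x ∷ xs) v∉ rewrite ≢⇒≡ᵇ-false {x} {v} (v∉ ∘ here ∘ sym) | firstOcc-∉ xs (v∉ ∘ there) = refl

firstOcc-first : ∀ {v} xs ys → v ∉ xs → firstOcc v (xs ++ v ∷ ys) ≡ suc (length xs)
firstOcc-first {v} [] ys _ rewrite ≡ᵇ-refl v = refl
firstOcc-first {v} (x ∷ xs) ys v∉ rewrite ≢⇒≡ᵇ-false {x} {v} (v∉ ∘ here ∘ sym) | firstOcc-first xs ys (v∉ ∘ there) = refl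

∈-splitFirst : ∀ {v} xs → v ∈ xs → ∃[ ys ] ∃[ zs ] xs ≡ ys ++ v ∷ zs × v ∉ ys
∈-splitFirst {v} (x ∷ xs) v∈ with x ≟ v | v∈
... | yes refl | _ = [] , xs , refl , λ ()
... | no x≢v | here v≡x = contradiction (sym v≡x) x≢v
... | no x≢v | there v∈xs = let (ys , zs , xs≡ , v∉ys) = ∈-splitFirst xs v∈xs in
  x ∷ ys , zs , cong (x ∷_) xs≡ , λ { (here v≡x) → x≢v (sym v≡x) ; (there v∈ys) → v∉ys v∈ys }

firstOcc-++ʳ : ∀ {v} xs ys → v ∉ xs → v ∈ ys → firstOcc v (xs ++ ys) ≡ length xs + firstOcc v ys
firstOcc-++ʳ {v} xs ys v∉xs v∈ys with ∈-splitFirst ys v∈ys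
... | ys₁ , ys₂ , refl , v∉ys₁ = begin
  firstOcc v (xs ++ ys₁ ++ v ∷ ys₂)    ≡⟨ cong (firstOcc v) (++-assoc xs ys₁ (v ∷ ys₂)) ⟨
  firstOcc v ((xs ++ ys₁) ++ v ∷ ys₂)  ≡⟨ firstOcc-first (xs ++ ys₁) ys₂ (∉-++⁺ xs v∉xs v∉ys₁) ⟩
  suc (length (xs ++ ys₁))             ≡⟨ cong suc (length-++ xs) ⟩
  suc (length xs + length ys₁)         ≡⟨ +-suc (length xs) (length ys₁) ⟨
  length xs + suc (length ys₁)         ≡⟨ cong (length xs +_) (firstOcc-first ys₁ ys₂ v∉ys₁) ⟨
  length xs + firstOcc v (ys₁ ++ v ∷ ys₂) ∎
  where open ≡-Reasoning

firstOcc-bounds : ∀ {v} xs → v ∈ xs → 1 ≤ firstOcc v xs × firstOcc v xs ≤ length xs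
firstOcc-bounds {v} xs v∈ with ∈-splitFirst xs v∈
... | ys , zs , refl , v∉ys rewrite firstOcc-first ys zs v∉ys =
  s≤s z≤n , subst (suc (length ys) ≤_) (sym (length-++ ys)) (subst (_≤ length ys + suc (length zs)) (+-comm (length ys) 1) (+-monoʳ-≤ (length ys) (s≤s z≤n)))

firstOcc≡0⇒∉ : ∀ {v} xs → firstOcc v xs ≡ 0 → v ∉ xs
firstOcc≡0⇒∉ xs ≡0 v∈ with firstOcc-bounds xs v∈
... | 1≤ , _ = contradiction (subst (1 ≤_) ≡0 1≤) λ ()

firstOcc≢0⇒∈ : ∀ {v} xs → firstOcc v xs ≢ 0 → v ∈ xs
firstOcc≢0⇒∈ {v} xs ≢0 with v ∈? xs
... | yes v∈ = v∈
... | no v∉ = contradiction (firstOcc-∉ xs v∉) ≢0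

-- Restricted growth functions

-- RGFFrom k xs: xs can follow a prefix of a restricted growth function whose largest letter is k.
data RGFFrom : ℕ → List ℕ → Set where
  [] : ∀ {k} → RGFFrom k []
  grow : ∀ {k x xs} → 1 ≤ x → x ≤ suc k → RGFFrom (k ⊔ x) xs → RGFFrom k (x ∷ xs)

rgfFrom⇒RGFFrom : ∀ k xs → T (rgfFrom k xs) → RGFFrom k xs
rgfFrom⇒RGFFrom k [] _ = []
rgfFrom⇒RGFFrom k (x ∷ xs) h =
  let (1≤x , h′) = T-∧⁻ {1 ≤ᵇ x} h ; (x≤k+1 , h″) = T-∧⁻ {x ≤ᵇ suc k} h′ in
  grow (≤ᵇ⇒≤ 1 x 1≤x) (≤ᵇ⇒≤ x (suc k) x≤k+1) (rgfFrom⇒RGFFrom (k ⊔ x) xs h″)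

RGFFrom⇒rgfFrom : ∀ {k xs} → RGFFrom k xs → T (rgfFrom k xs)
RGFFrom⇒rgfFrom [] = _
RGFFrom⇒rgfFrom (grow 1≤x x≤k+1 r) = T-∧⁺ (≤⇒≤ᵇ 1≤x) (T-∧⁺ (≤⇒≤ᵇ x≤k+1) (RGFFrom⇒rgfFrom r))

isRGF⇒RGFFrom : ∀ π → T (isRGF π) → RGFFrom 0 π
isRGF⇒RGFFrom [] _ = []
isRGF⇒RGFFrom (x ∷ xs) h with T-∧⁻ {x ≡ᵇ 1} h
... | x≡1 , h′ rewrite ≡ᵇ⇒≡ x 1 x≡1 = grow ≤-refl ≤-refl (rgfFrom⇒RGFFrom 1 xs h′)

RGFFrom⇒isRGF : ∀ {π} → RGFFrom 0 π → T (isRGF π)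
RGFFrom⇒isRGF [] = _
RGFFrom⇒isRGF (grow {x = suc zero} _ _ r) = RGFFrom⇒rgfFrom r
RGFFrom⇒isRGF (grow {x = suc (suc _)} _ (s≤s ()) _)

RGFFrom-++⁻ : ∀ {k} xs {ys} → RGFFrom k (xs ++ ys) → RGFFrom k xs × RGFFrom (k ⊔ maxL xs) ys
RGFFrom-++⁻ {k} [] r = [] , subst (λ m → RGFFrom m _) (sym (⊔-identityʳ k)) r
RGFFrom-++⁻ {k} (x ∷ xs) (grow 1≤x x≤ r) =
  let (rxs , rys) = RGFFrom-++⁻ xs r in grow 1≤x x≤ rxs , subst (λ m → RGFFrom m _) (⊔-assoc k x (maxL xs)) rys

RGFFrom-++⁺ : ∀ {k} xs {ys} → RGFFrom k xs → RGFFrom (k ⊔ maxL xs) ys → RGFFrom k (xs ++ ys)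
RGFFrom-++⁺ {k} [] [] r = subst (λ m → RGFFrom m _) (⊔-identityʳ k) r
RGFFrom-++⁺ {k} (x ∷ xs) (grow 1≤x x≤ rxs) rys =
  grow 1≤x x≤ (RGFFrom-++⁺ xs rxs (subst (λ m → RGFFrom m _) (sym (⊔-assoc k x (maxL xs))) rys))

RGFFrom-weaken : ∀ {k k′ xs} → k ≤ k′ → RGFFrom k xs → RGFFrom k′ xs
RGFFrom-weaken k≤k′ [] = []
RGFFrom-weaken k≤k′ (grow {x = x} 1≤x x≤ r) = grow 1≤x (≤-trans x≤ (s≤s k≤k′)) (RGFFrom-weaken (⊔-monoˡ-≤ x k≤k′) r)

RGFFrom-full : ∀ {k xs} → All (Letter (suc k)) xs → RGFFrom k xs
RGFFrom-full [] = []
RGFFrom-full {k} ((1≤x , x≤) ∷ letters) = grow 1≤x x≤ (RGFFrom-weaken (m≤m⊔n k _) (RGFFrom-full letters))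

RGFFrom-letters : ∀ {k xs} → RGFFrom k xs → All (Letter (k + length xs)) xs
RGFFrom-letters [] = []
RGFFrom-letters {k} {x ∷ xs} (grow 1≤x x≤ r) =
  (1≤x , subst (x ≤_) (sym (+-suc k (length xs))) (≤-trans x≤ (s≤s (m≤m+n k (length xs)))))
  ∷ All.map (λ (1≤y , y≤) → 1≤y , ≤-trans y≤ bound) (RGFFrom-letters r)
  where
  bound : (k ⊔ x) + length xs ≤ k + suc (length xs)
  bound = ≤-trans (+-monoˡ-≤ (length xs) (⊔-lub (n≤1+n k) x≤)) (≤-reflexive (sym (+-suc k (length xs))))

RGFFrom-attains : ∀ {k} xs → RGFFrom k xs → ∀ {z} → 1 ≤ z → z ≤ k ⊔ maxL xs → z ≤ k ⊎ z ∈ xs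
RGFFrom-attains {k} [] [] 1≤z z≤ = inj₁ (subst (_ ≤_) (⊔-identityʳ k) z≤)
RGFFrom-attains {k} (x ∷ xs) (grow 1≤x x≤ r) {z} 1≤z z≤
  with RGFFrom-attains xs r 1≤z (subst (z ≤_) (sym (⊔-assoc k x (maxL xs))) z≤)
... | inj₂ z∈ = inj₂ (there z∈)
... | inj₁ z≤k⊔x with ≤-total x k
...   | inj₁ x≤k = inj₁ (subst (z ≤_) (m≥n⇒m⊔n≡m x≤k) z≤k⊔x)
...   | inj₂ k≤x with m≤n⇒m<n∨m≡n (subst (z ≤_) (m≤n⇒m⊔n≡n k≤x) z≤k⊔x)
...     | inj₂ refl = inj₂ (here refl)
...     | inj₁ z<x = inj₁ (≤-pred (≤-trans z<x x≤))

RGFFrom-++-full : ∀ {k} xs {ys} → RGFFrom k xs → All (Letter (suc (k ⊔ maxL xs))) ys → RGFFrom k (xs ++ ys)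
RGFFrom-++-full xs rxs letters = RGFFrom-++⁺ xs rxs (RGFFrom-full letters)

RGFFrom-positive : ∀ {k xs} → RGFFrom k xs → All (1 ≤_) xs
RGFFrom-positive r = All.map proj₁ (RGFFrom-letters r)

RGFFrom⇒∈words : ∀ {n π} → RGFFrom 0 π → length π ≡ n → π ∈ words n n
RGFFrom⇒∈words {π = π} r |π|≡n = ∈-words⁺ |π|≡n (All.map (λ (1≤x , x≤) → 1≤x , subst (_ ≤_) |π|≡n x≤) (RGFFrom-letters r))

RGFFrom-splitFirst : ∀ {c π} → RGFFrom 0 π → suc c ∈ π → 1 ≤ c → ∃[ x ] ∃[ y ] π ≡ x ++ suc c ∷ y × suc c ∉ x × c ∈ x
RGFFrom-splitFirst {c} {π} rgf c+1∈π 1≤c with ∈-splitFirst π c+1∈π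
... | x , y , refl , c+1∉x with proj₂ (RGFFrom-++⁻ x rgf)
...   | grow _ c+1≤ _ with RGFFrom-attains x (proj₁ (RGFFrom-++⁻ x rgf)) 1≤c (≤-pred c+1≤)
...     | inj₁ c≤0 = contradiction (≤-trans 1≤c c≤0) λ ()
...     | inj₂ c∈x = x , y , refl , c+1∉x , c∈x

-- The pattern 12123

pattern12123 : ℕ → ℕ → ℕ → List ℕ
pattern12123 a b e = a ∷ b ∷ a ∷ b ∷ e ∷ []

Contains12123 : List ℕ → Set
Contains12123 π = ∃[ a ] ∃[ b ] ∃[ e ] a < b × b < e × pattern12123 a b e ⊆ π

Contains12123-mono : ∀ {π π′} → π ⊆ π′ → Contains12123 π → Contains12123 π′
Contains12123-mono π⊆π′ (a , b , e , a<b , b<e , p) = a , b , e , a<b , b<e , ⊆-trans p π⊆π′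

choose⇒⊆ : ∀ {w : List A} k (xs : List A) → w ∈ choose k xs → w ⊆ xs
choose⇒⊆ zero xs (here refl) = minimum xs
choose⇒⊆ (suc k) (x ∷ xs) w∈ with ∈-++⁻ (map (x ∷_) (choose k xs)) w∈
... | inj₁ w∈map with ∈-map⁻ (x ∷_) w∈map
...   | w′ , w′∈ , refl = refl ∷ choose⇒⊆ k xs w′∈
choose⇒⊆ (suc k) (x ∷ xs) w∈ | inj₂ w∈rest = x ∷ʳ choose⇒⊆ (suc k) xs w∈rest

⊆⇒choose : ∀ {w xs : List A} → w ⊆ xs → w ∈ choose (length w) xs
⊆⇒choose [] = here refl
⊆⇒choose {w = []} (y ∷ʳ _) = here refl
⊆⇒choose {w = w ∷ ws} (y ∷ʳ p) = ∈-++⁺ʳ (map (y ∷_) (choose (length ws) _)) (⊆⇒choose p)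
⊆⇒choose (refl ∷ p) = ∈-++⁺ˡ (∈-map⁺ _ (⊆⇒choose p))

T-any⁻ : (p : A → Bool) (xs : List A) → T (any p xs) → ∃[ x ] x ∈ xs × T (p x)
T-any⁻ p (x ∷ xs) h with p x in eq
... | true = x , here refl , subst T (sym eq) _
... | false = let (y , y∈ , py) = T-any⁻ p xs h in y , there y∈ , py

T-any⁺ : (p : A → Bool) {x : A} (xs : List A) → x ∈ xs → T (p x) → T (any p xs)
T-any⁺ p (y ∷ xs) x∈ px with p y in eq
... | true = _
... | false with x∈
...   | here refl = ⊥-elim (subst T eq px)
...   | there x∈xs = T-any⁺ p xs x∈xs px

is12123⇒pattern : ∀ w → T (is12123 w) → ∃[ a ] ∃[ b ] ∃[ e ] w ≡ pattern12123 a b e × a < b × b < e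
is12123⇒pattern (a ∷ b ∷ a′ ∷ b′ ∷ e ∷ []) h =
  let (a≡a′ , h₁) = T-∧⁻ {a ≡ᵇ a′} h ; (b≡b′ , h₂) = T-∧⁻ {b ≡ᵇ b′} h₁ ; (a<b , b<e) = T-∧⁻ {a <ᵇ b} h₂ in
  a , b , e , cong₂ (λ x y → a ∷ b ∷ x ∷ y ∷ e ∷ []) (sym (≡ᵇ⇒≡ a a′ a≡a′)) (sym (≡ᵇ⇒≡ b b′ b≡b′)) , <ᵇ⇒< a b a<b , <ᵇ⇒< b e b<e

contains12123⇔Contains12123 : ∀ π → T (contains12123 π) ⇔ Contains12123 π
contains12123⇔Contains12123 π = mk⇔ to from
  where
  to : T (contains12123 π) → Contains12123 π
  to h with T-any⁻ is12123 (choose 5 π) h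
  ... | w , w∈ , is with is12123⇒pattern w is
  ...   | a , b , e , refl , a<b , b<e = a , b , e , a<b , b<e , choose⇒⊆ 5 π w∈
  from : Contains12123 π → T (contains12123 π)
  from (a , b , e , a<b , b<e , p) = T-any⁺ is12123 (choose 5 π) (⊆⇒choose p)
    (T-∧⁺ {a ≡ᵇ a} (≡⇒≡ᵇ a a refl) (T-∧⁺ {b ≡ᵇ b} (≡⇒≡ᵇ b b refl) (T-∧⁺ {a <ᵇ b} (<⇒<ᵇ a<b) (<⇒<ᵇ b<e))))

⊆-split : ∀ {w : List A} xs {c ys} → w ⊆ xs ++ c ∷ ys →
  w ⊆ xs ++ ys ⊎ ∃[ w₁ ] ∃[ w₂ ] w ≡ w₁ ++ c ∷ w₂ × w₁ ⊆ xs × w₂ ⊆ ys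
⊆-split [] (_ ∷ʳ p) = inj₁ p
⊆-split [] (refl ∷ p) = inj₂ ([] , _ , refl , [] , p)
⊆-split (x ∷ xs) (.x ∷ʳ p) with ⊆-split xs p
... | inj₁ q = inj₁ (x ∷ʳ q)
... | inj₂ (w₁ , w₂ , refl , p₁ , p₂) = inj₂ (w₁ , w₂ , refl , x ∷ʳ p₁ , p₂)
⊆-split (x ∷ xs) (refl ∷ p) with ⊆-split xs p
... | inj₁ q = inj₁ (refl ∷ q)
... | inj₂ (w₁ , w₂ , refl , p₁ , p₂) = inj₂ (x ∷ w₁ , w₂ , refl , refl ∷ p₁ , p₂)

⊆-dropBlock : ∀ {w : List A} xs r {c ys} → c ∉ w → w ⊆ xs ++ replicate r c ++ ys → w ⊆ xs ++ ys
⊆-dropBlock xs zero c∉w p = p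
⊆-dropBlock xs (suc r) c∉w p with ⊆-split xs p
... | inj₁ q = ⊆-dropBlock xs r c∉w q
... | inj₂ (w₁ , w₂ , refl , _ , _) = contradiction (∈-++⁺ʳ w₁ (here refl)) c∉w

⊆-dropPrefix : ∀ {v : A} {w} xs {ys} → v ∉ xs → v ∷ w ⊆ xs ++ ys → v ∷ w ⊆ ys
⊆-dropPrefix [] v∉ p = p
⊆-dropPrefix (x ∷ xs) v∉ (.x ∷ʳ p) = ⊆-dropPrefix xs (v∉ ∘ there) p
⊆-dropPrefix (x ∷ xs) v∉ (refl ∷ p) = contradiction (here refl) v∉

pattern-through-max : ∀ {a b e c} w₁ w₂ → w₁ ++ c ∷ w₂ ≡ pattern12123 a b e →
  a < b → b < e → e ≤ c → w₁ ≡ a ∷ b ∷ a ∷ b ∷ []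
pattern-through-max [] _ refl a<b b<e e≤a = contradiction e≤a (<⇒≱ (<-trans a<b b<e))
pattern-through-max (_ ∷ []) _ refl a<b b<e e≤b = contradiction e≤b (<⇒≱ b<e)
pattern-through-max (_ ∷ _ ∷ []) _ refl a<b b<e e≤a = contradiction e≤a (<⇒≱ (<-trans a<b b<e))
pattern-through-max (_ ∷ _ ∷ _ ∷ []) _ refl a<b b<e e≤b = contradiction e≤b (<⇒≱ b<e)
pattern-through-max (_ ∷ _ ∷ _ ∷ _ ∷ []) _ refl _ _ _ = refl
pattern-through-max (_ ∷ _ ∷ _ ∷ _ ∷ _ ∷ []) _ ()
pattern-through-max (_ ∷ _ ∷ _ ∷ _ ∷ _ ∷ _ ∷ _) _ ()

-- An occurrence of 12123 passing through a largest letter uses it as the final 3.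
⊆-splitMax : ∀ {a b e c} xs {ys} → All (_≤ c) (xs ++ c ∷ ys) → a < b → b < e →
  pattern12123 a b e ⊆ xs ++ c ∷ ys → pattern12123 a b e ⊆ xs ++ ys ⊎ a ∷ b ∷ a ∷ b ∷ [] ⊆ xs
⊆-splitMax xs ≤c a<b b<e p with ⊆-split xs p
... | inj₁ q = inj₁ q
... | inj₂ (w₁ , w₂ , eq , p₁ , _) with All-resp-⊆ p ≤c
...   | _ ∷ _ ∷ _ ∷ _ ∷ e≤c ∷ [] with pattern-through-max w₁ w₂ (sym eq) a<b b<e e≤c
...     | refl = inj₂ p₁

⊆-splitMaxBlock : ∀ {a b e c} xs r {ys} → All (_≤ c) (xs ++ replicate r c ++ ys) → a < b → b < e →
  pattern12123 a b e ⊆ xs ++ replicate r c ++ ys → pattern12123 a b e ⊆ xs ++ ys ⊎ a ∷ b ∷ a ∷ b ∷ [] ⊆ xs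
⊆-splitMaxBlock xs zero ≤c a<b b<e p = inj₁ p
⊆-splitMaxBlock xs (suc r) ≤c a<b b<e p with ⊆-splitMax xs ≤c a<b b<e p
... | inj₁ q = ⊆-splitMaxBlock xs r (All.++⁺ (All.++⁻ˡ xs ≤c) (All.tail (All.++⁻ʳ xs ≤c))) a<b b<e q
... | inj₂ q = inj₂ q

pattern-top-≤ : ∀ {a b e c π} → pattern12123 a b e ⊆ π → All (_≤ c) π → e ≤ c
pattern-top-≤ p ≤c with All-resp-⊆ p ≤c
... | _ ∷ _ ∷ _ ∷ _ ∷ e≤c ∷ [] = e≤c

Letters≤2⇒¬Contains12123 : ∀ {π} → All (Letter 2) π → ¬ Contains12123 π
Letters≤2⇒¬Contains12123 letters (a , b , e , a<b , b<e , p) with All-resp-⊆ p letters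
... | (1≤a , _) ∷ _ ∷ _ ∷ _ ∷ (_ , e≤2) ∷ [] = <⇒≱ (≤-trans (s≤s (≤-trans (s≤s 1≤a) a<b)) b<e) e≤2

Contains12123-dropRepeatedMax : ∀ {m} xs {zs} → All (_≤ m) (xs ++ m ∷ zs) → m ∈ zs →
  Contains12123 (xs ++ m ∷ zs) → Contains12123 (xs ++ zs)
Contains12123-dropRepeatedMax xs ≤m m∈zs (a , b , e , a<b , b<e , p) with ⊆-splitMax xs ≤m a<b b<e p
... | inj₁ q = a , b , e , a<b , b<e , q
... | inj₂ q = a , b , _ , a<b , <-≤-trans b<e (pattern-top-≤ p ≤m) , ++⁺ q (from∈ m∈zs)

Contains12123-raiseMax : ∀ {c} xs {xs′ ys} → All (_≤ c) (xs ++ c ∷ ys) → xs ⊆ xs′ →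
  Contains12123 (xs ++ c ∷ ys) → Contains12123 (xs′ ++ suc c ∷ ys)
Contains12123-raiseMax {c} xs {ys = ys} ≤c xs⊆xs′ (a , b , e , a<b , b<e , p) with ⊆-splitMax xs ≤c a<b b<e p
... | inj₁ q = a , b , e , a<b , b<e , ⊆-trans q (++⁺ xs⊆xs′ (suc c ∷ʳ ⊆-refl))
... | inj₂ q = a , b , suc c , a<b , <-≤-trans b<e (m≤n⇒m≤1+n (pattern-top-≤ p ≤c)) , ++⁺ (⊆-trans q xs⊆xs′) (refl ∷ minimum ys)

¬acac : ∀ {a c} u r δ → c ∉ u → c ∉ δ → a ≢ c → ¬ (a ∷ c ∷ a ∷ c ∷ [] ⊆ u ++ replicate r c ++ δ)
¬acac u r δ c∉u c∉δ a≢c p =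
  let cac = ⊆-dropPrefix u c∉u (∷ˡ⁻ p) ; ac = ⊆-dropPrefix (replicate r _) (∉-replicate r a≢c) (∷ˡ⁻ cac) in
  c∉δ (to∈ (∷ˡ⁻ ac))

Contains12123-lowerMax : ∀ {c} u r δ {y} → All (_< c) u → All (_< c) δ → All (_≤ c) y →
  Contains12123 (u ++ replicate r c ++ δ ++ suc c ∷ y) → Contains12123 (u ++ δ ++ c ∷ y)
Contains12123-lowerMax {c} u r δ {y} u<c δ<c y≤c (a , b , e , a<b , b<e , p) =
  [ belowTop , throughTop ]′ (⊆-splitMax (u ++ c^r ++ δ) ≤c+1 a<b b<e p′)
  where
  c^r = replicate r c
  p′ : pattern12123 a b e ⊆ (u ++ c^r ++ δ) ++ suc c ∷ y
  p′ = subst (pattern12123 a b e ⊆_) (sym (trans (++-assoc u (c^r ++ δ) (suc c ∷ y)) (cong (u ++_) (++-assoc c^r δ (suc c ∷ y))))) p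
  ≤c+1 : All (_≤ suc c) ((u ++ c^r ++ δ) ++ suc c ∷ y)
  ≤c+1 = All.++⁺ (All.++⁺ (All.map (m≤n⇒m≤1+n ∘ <⇒≤) u<c) (All.++⁺ (All.replicate⁺ r (n≤1+n c)) (All.map (m≤n⇒m≤1+n ∘ <⇒≤) δ<c)))
                 (≤-refl ∷ All.map m≤n⇒m≤1+n y≤c)
  belowTop : pattern12123 a b e ⊆ (u ++ c^r ++ δ) ++ y → Contains12123 (u ++ δ ++ c ∷ y)
  belowTop q = [ (λ q′ → a , b , e , a<b , b<e , ⊆-trans q′ (++⁺ (⊆-refl {x = u}) (++⁺ (⊆-refl {x = δ}) (c ∷ʳ ⊆-refl))))
               , (λ q′ → a , b , c , a<b , <-≤-trans b<e (pattern-top-≤ q″ ≤c) , ++⁺ q′ (++⁺ˡ δ (refl ∷ minimum y))) ]′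
               (⊆-splitMaxBlock u r ≤c a<b b<e q″)
    where
    q″ : pattern12123 a b e ⊆ u ++ c^r ++ δ ++ y
    q″ = subst (pattern12123 a b e ⊆_) (trans (++-assoc u (c^r ++ δ) y) (cong (u ++_) (++-assoc c^r δ y))) q
    ≤c : All (_≤ c) (u ++ c^r ++ δ ++ y)
    ≤c = All.++⁺ (All.map <⇒≤ u<c) (All.++⁺ (All.replicate⁺ r ≤-refl) (All.++⁺ (All.map <⇒≤ δ<c) y≤c))
  throughTop : a ∷ b ∷ a ∷ b ∷ [] ⊆ u ++ c^r ++ δ → Contains12123 (u ++ δ ++ c ∷ y)
  throughTop q with m≤n⇒m<n∨m≡n (≤-pred (<-≤-trans b<e (pattern-top-≤ p′ ≤c+1)))
  ... | inj₂ refl = contradiction q (¬acac u r δ (All<⇒∉ u<c) (All<⇒∉ δ<c) (<⇒≢ a<b))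
  ... | inj₁ b<c = a , b , c , a<b , b<c , subst (pattern12123 a b c ⊆_) (++-assoc u δ (c ∷ y))
    (++⁺ (⊆-dropBlock u r (All<⇒∉ (a<c ∷ b<c ∷ a<c ∷ b<c ∷ [])) q) (refl ∷ minimum y))
    where a<c = <-trans a<b b<c

-- The shape of a member of A_{n,t,s}

record InA (t s : ℕ) (π : List ℕ) : Set where
  field
    rgf : RGFFrom 0 π
    avoids : ¬ Contains12123 π
    2≤max : 2 ≤ maxL π
    firstMax : firstOcc (maxL π) π ≡ t
    firstSecond : firstOcc (secondMax π) π ≡ s

T-inA⇔InA : ∀ {t s} π → T (inA t s π) ⇔ InA t s π
T-inA⇔InA {t} {s} π = mk⇔ to from
  where
  to : T (inA t s π) → InA t s π
  to h =
    let (isR , h₁) = T-∧⁻ {isRGF π} h ; (av , h₂) = T-∧⁻ {not (contains12123 π)} h₁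
        (2≤ , h₃) = T-∧⁻ {2 ≤ᵇ maxL π} h₂ ; (tH , sH) = T-∧⁻ {firstOcc (maxL π) π ≡ᵇ t} h₃ in
    record { rgf = isRGF⇒RGFFrom π isR
           ; avoids = T-not⁻ av ∘ Equivalence.from (contains12123⇔Contains12123 π)
           ; 2≤max = ≤ᵇ⇒≤ 2 (maxL π) 2≤
           ; firstMax = ≡ᵇ⇒≡ _ t tH
           ; firstSecond = ≡ᵇ⇒≡ _ s sH }
  from : InA t s π → T (inA t s π)
  from m = T-∧⁺ {isRGF π} (RGFFrom⇒isRGF rgf)
          (T-∧⁺ {not (contains12123 π)} (T-not⁺ (avoids ∘ Equivalence.to (contains12123⇔Contains12123 π)))
          (T-∧⁺ {2 ≤ᵇ maxL π} (≤⇒≤ᵇ 2≤max)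
          (T-∧⁺ {firstOcc (maxL π) π ≡ᵇ t} (≡⇒≡ᵇ _ t firstMax) (≡⇒≡ᵇ _ s firstSecond))))
    where open InA m

inA? : ∀ t s → Decidable (λ π → T (inA t s π))
inA? t s π = T? (inA t s π)

-- In a member of A_{n,t,s}, c + 1 and c are the two largest letters, first occurring at t and s.
shapeWord : ℕ → List ℕ → List ℕ → List ℕ → List ℕ
shapeWord c u v y = u ++ c ∷ v ++ suc c ∷ y

record Shaped (c : ℕ) (u v y : List ℕ) : Set where
  field
    1≤c : 1 ≤ c
    bounded : All (_≤ suc c) (shapeWord c u v y)
    c∉u : c ∉ u
    c+1∉u : suc c ∉ u
    c+1∉v : suc c ∉ v
    rgf : RGFFrom 0 (shapeWord c u v y)
    avoids : ¬ Contains12123 (shapeWord c u v y)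

record Shape (t s : ℕ) (π : List ℕ) : Set where
  constructor shape
  field
    {c} : ℕ
    {u v y} : List ℕ
    π≡ : π ≡ shapeWord c u v y
    shaped : Shaped c u v y
    s≡ : s ≡ suc (length u)
    t≡ : t ≡ suc (length u + suc (length v))

shapeWord-assoc : ∀ c u v y → (u ++ c ∷ v) ++ suc c ∷ y ≡ shapeWord c u v y
shapeWord-assoc c u v y = ++-assoc u (c ∷ v) (suc c ∷ y)

shapeWord-++ : ∀ c u v₁ v₂ y → shapeWord c u (v₁ ++ v₂) y ≡ (u ++ c ∷ v₁) ++ v₂ ++ suc c ∷ y
shapeWord-++ c u v₁ v₂ y =
  trans (cong (λ w → u ++ c ∷ w) (++-assoc v₁ v₂ (suc c ∷ y))) (sym (++-assoc u (c ∷ v₁) (v₂ ++ suc c ∷ y)))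

length-shapeWord : ∀ c u v y → length (shapeWord c u v y) ≡ suc (length u + suc (length v)) + length y
length-shapeWord c u v y = begin
  length (u ++ c ∷ v ++ suc c ∷ y)          ≡⟨ length-++ u ⟩
  length u + suc (length (v ++ suc c ∷ y))  ≡⟨ cong (λ l → length u + suc l) (length-++ v) ⟩
  length u + suc (length v + suc (length y)) ≡⟨ rearrange (length u) (length v) (length y) ⟩
  suc (length u + suc (length v)) + length y ∎
  where
  open ≡-Reasoning
  rearrange : ∀ a b d → a + suc (b + suc d) ≡ suc (a + suc b) + d
  rearrange = solve-∀

module Shaped-properties {c u v y} (sh : Shaped c u v y) where
  open Shaped sh

  c+1∉u++c∷v : suc c ∉ u ++ c ∷ v
  c+1∉u++c∷v = ∉-++⁺ u c+1∉u λ { (here c+1≡c) → 1+n≢n c+1≡c ; (there c+1∈v) → c+1∉v c+1∈v }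

  maxL≡ : maxL (shapeWord c u v y) ≡ suc c
  maxL≡ = maxL-≡ (shapeWord c u v y) bounded (∈-++⁺ʳ u (there (∈-++⁺ʳ v (here refl))))

  secondMax≡ : secondMax (shapeWord c u v y) ≡ c
  secondMax≡ = secondMax-≡ (shapeWord c u v y) maxL≡ (∈-++⁺ʳ u (here refl))

  firstOcc-c : firstOcc c (shapeWord c u v y) ≡ suc (length u)
  firstOcc-c = firstOcc-first u (v ++ suc c ∷ y) c∉u

  firstOcc-c+1 : firstOcc (suc c) (shapeWord c u v y) ≡ suc (length u + suc (length v))
  firstOcc-c+1 = begin
    firstOcc (suc c) (shapeWord c u v y)          ≡⟨ cong (firstOcc (suc c)) (shapeWord-assoc c u v y) ⟨
    firstOcc (suc c) ((u ++ c ∷ v) ++ suc c ∷ y)  ≡⟨ firstOcc-first (u ++ c ∷ v) y c+1∉u++c∷v ⟩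
    suc (length (u ++ c ∷ v))                     ≡⟨ cong suc (length-++ u) ⟩
    suc (length u + suc (length v))               ∎
    where open ≡-Reasoning

  InA-shapeWord : InA (suc (length u + suc (length v))) (suc (length u)) (shapeWord c u v y)
  InA-shapeWord = record
    { rgf = rgf
    ; avoids = avoids
    ; 2≤max = subst (2 ≤_) (sym maxL≡) (s≤s 1≤c)
    ; firstMax = trans (cong (λ m → firstOcc m (shapeWord c u v y)) maxL≡) firstOcc-c+1
    ; firstSecond = trans (cong (λ m → firstOcc m (shapeWord c u v y)) secondMax≡) firstOcc-c }

  u<c : All (_< c) u
  u<c = All≤∧∉⇒All< (All≤suc⇒All≤ (All.++⁻ˡ u bounded) c+1∉u) c∉u

  v≤c : All (_≤ c) v
  v≤c = All≤suc⇒All≤ (All.++⁻ˡ v (All.tail (All.++⁻ʳ u bounded))) c+1∉v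

  y≤c+1 : All (_≤ suc c) y
  y≤c+1 = All.tail (All.++⁻ʳ v (All.tail (All.++⁻ʳ u bounded)))

  c≤1+maxL-u : c ≤ suc (maxL u)
  c≤1+maxL-u with proj₂ (RGFFrom-++⁻ u rgf)
  ... | grow _ c≤ _ = c≤

InA⇒Shape : ∀ {t s} π → InA t s π → Shape t s π
InA⇒Shape {t} {s} π m with 2≤⇒≡suc (InA.2≤max m)
... | c , max≡ , 1≤c with RGFFrom-splitFirst (InA.rgf m) (subst (_∈ π) max≡ (maxL-∈ π (subst (1 ≤_) (sym max≡) (s≤s z≤n)))) 1≤c
...   | x , y , refl , c+1∉x , c∈x with ∈-splitFirst x c∈x
...     | u , v , refl , c∉u = shape π≡ sh s≡ t≡
  where
  open InA m
  π≡ = shapeWord-assoc c u v y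
  sh : Shaped c u v y
  sh = record
    { 1≤c = 1≤c
    ; bounded = subst₂ (λ k π → All (_≤ k) π) max≡ π≡ (All-≤-maxL ((u ++ c ∷ v) ++ suc c ∷ y))
    ; c∉u = c∉u
    ; c+1∉u = c+1∉x ∘ ∈-++⁺ˡ
    ; c+1∉v = c+1∉x ∘ ∈-++⁺ʳ u ∘ there
    ; rgf = subst (RGFFrom 0) π≡ rgf
    ; avoids = avoids ∘ subst Contains12123 (sym π≡) }
  module W = InA (Shaped-properties.InA-shapeWord sh)
  s≡ : s ≡ suc (length u)
  s≡ = trans (sym firstSecond) (trans (cong (λ π → firstOcc (secondMax π) π) π≡) W.firstSecond)
  t≡ : t ≡ suc (length u + suc (length v))
  t≡ = trans (sym firstMax) (trans (cong (λ π → firstOcc (maxL π) π) π≡) W.firstMax)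

a-support : ∀ n t s → a n t s ≢ 0 → (2 ≤ n) × (1 ≤ s) × (s < t) × (t ≤ n)
a-support n t s a≢0 with count≢0⇒∃ (λ π → T? (inA t s π)) (words n n) a≢0
... | π , π∈ , π∈A with InA⇒Shape π (Equivalence.to (T-inA⇔InA π) π∈A)
...   | shape {c} {u} {v} {y} refl _ refl refl = ≤-trans 2≤t t≤n , s≤s z≤n , s<t , t≤n
  where
  2≤t : 2 ≤ suc (length u + suc (length v))
  2≤t = s≤s (≤-trans (s≤s z≤n) (m≤n+m (suc (length v)) (length u)))
  s<t : suc (length u) < suc (length u + suc (length v))
  s<t = s≤s (subst (_≤ length u + suc (length v)) (+-comm (length u) 1) (+-monoʳ-≤ (length u) (s≤s z≤n)))
  t≤n : suc (length u + suc (length v)) ≤ n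
  t≤n = subst (_ ≤_) (trans (sym (length-shapeWord c u v y)) (proj₁ (∈-words⁻ π∈))) (m≤m+n _ (length y))

-- The case s = 1

Shaped-[]⇒c≡1 : ∀ {c v y} → Shaped c [] v y → c ≡ 1
Shaped-[]⇒c≡1 sh with Shaped.rgf sh
... | grow 1≤c c≤1 _ = ≤-antisym c≤1 1≤c

onesThenTwo : ℕ → List ℕ → List ℕ
onesThenTwo k = shapeWord 1 [] (replicate k 1)

Shaped-onesThenTwo : ∀ k {w} → All (Letter 2) w → Shaped 1 [] (replicate k 1) w
Shaped-onesThenTwo k {w} w∈12 = record
  { 1≤c = ≤-refl
  ; bounded = All.map proj₂ letters
  ; c∉u = λ ()
  ; c+1∉u = λ ()
  ; c+1∉v = ∉-replicate k (λ ())
  ; rgf = RGFFrom-++-full (1 ∷ []) (grow ≤-refl ≤-refl []) (All.tail letters)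
  ; avoids = Letters≤2⇒¬Contains12123 letters }
  where
  letters : All (Letter 2) (onesThenTwo k w)
  letters = (≤-refl , s≤s z≤n) ∷ All.++⁺ (All.replicate⁺ k (≤-refl , s≤s z≤n)) ((s≤s z≤n , ≤-refl) ∷ w∈12)

onesThenTwo-forward : ∀ {n k π} → let t = suc (suc k) in π ∈ words n n → T (inA t 1 π) →
  (drop t π ∈ words (n ∸ t) 2 × U (drop t π)) × onesThenTwo k (drop t π) ≡ π
onesThenTwo-forward {n} {k} {π} π∈ π∈A with InA⇒Shape π (Equivalence.to (T-inA⇔InA π) π∈A)
... | shape {u = _ ∷ _} _ _ () _
... | shape {c} {[]} {v} {y} refl sh refl t≡ with Shaped-[]⇒c≡1 sh
...   | refl = (subst (_∈ words (n ∸ t) 2) (sym drop-t) (∈-words⁺ |y|≡ y∈12) , _) , inverse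
  where
  open Shaped sh
  t = suc (suc k)
  |v|≡k : length v ≡ k
  |v|≡k = suc-injective (suc-injective (sym t≡))
  drop-t : drop t (shapeWord 1 [] v y) ≡ y
  drop-t = drop-++-∷ v |v|≡k
  y∈12 : All (Letter 2) y
  y∈12 = subst (All (Letter 2)) drop-t (All.zip (All.drop⁺ t (RGFFrom-positive rgf) , All.drop⁺ t bounded))
  |y|≡ : length y ≡ n ∸ t
  |y|≡ = begin
    length y              ≡⟨ m+n∸m≡n t (length y) ⟨
    t + length y ∸ t      ≡⟨ cong (λ l → l + length y ∸ t) t≡ ⟩
    _                     ≡⟨ cong (_∸ t) (trans (sym (length-shapeWord 1 [] v y)) (proj₁ (∈-words⁻ {n} {n} π∈))) ⟩
    n ∸ t                 ∎
    where open ≡-Reasoning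
  v≡1ᵏ : v ≡ replicate k 1
  v≡1ᵏ = trans (All≡⇒replicate v (All.zipWith (λ (1≤x , x≤1) → ≤-antisym x≤1 1≤x)
                  (All.++⁻ˡ v (All.tail (RGFFrom-positive rgf)) , All≤suc⇒All≤ (All.++⁻ˡ v (All.tail bounded)) c+1∉v)))
               (cong (λ l → replicate l 1) |v|≡k)
  inverse : onesThenTwo k (drop t (shapeWord 1 [] v y)) ≡ shapeWord 1 [] v y
  inverse = trans (cong (onesThenTwo k) drop-t) (cong (λ v′ → shapeWord 1 [] v′ y) (sym v≡1ᵏ))

onesThenTwo-backward : ∀ {n k w} → let t = suc (suc k) in t ≤ n → w ∈ words (n ∸ t) 2 →
  (onesThenTwo k w ∈ words n n × T (inA t 1 (onesThenTwo k w))) × drop t (onesThenTwo k w) ≡ w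
onesThenTwo-backward {n} {k} {w} t≤n w∈ =
  (RGFFrom⇒∈words (Shaped.rgf sh) |π|≡n , Equivalence.from (T-inA⇔InA _) π∈A) , drop-++-∷ (replicate k 1) (length-replicate k)
  where
  t = suc (suc k)
  sh = Shaped-onesThenTwo k (proj₂ (∈-words⁻ {n ∸ t} w∈))
  π∈A : InA t 1 (onesThenTwo k w)
  π∈A = subst (λ l → InA (suc (suc l)) 1 (onesThenTwo k w)) (length-replicate k) (Shaped-properties.InA-shapeWord sh)
  |π|≡n : length (onesThenTwo k w) ≡ n
  |π|≡n = begin
    length (onesThenTwo k w)                       ≡⟨ length-shapeWord 1 [] (replicate k 1) w ⟩
    suc (suc (length (replicate k 1))) + length w  ≡⟨ cong₂ (λ l l′ → suc (suc l) + l′) (length-replicate k) (proj₁ (∈-words⁻ w∈)) ⟩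
    t + (n ∸ t)                                    ≡⟨ m+[n∸m]≡n t≤n ⟩
    n                                              ∎
    where open ≡-Reasoning

a-secondAt1 : ∀ n t → 2 ≤ t → t ≤ n → a n t 1 ≡ 2 ^ (n ∸ t)
a-secondAt1 n (suc zero) (s≤s ()) _
a-secondAt1 n (suc (suc k)) _ t≤n = begin
  a n t 1                     ≡⟨ count-bijection (inA? t 1) U? (words-unique n n) (words-unique (n ∸ t) 2)
                                   (drop t) (onesThenTwo k) (onesThenTwo-forward {n}) (λ w∈ _ → onesThenTwo-backward t≤n w∈) ⟩
  count U? (words (n ∸ t) 2)  ≡⟨ count-all U? {words (n ∸ t) 2} _ ⟩
  length (words (n ∸ t) 2)    ≡⟨ length-words (n ∸ t) 2 ⟩
  2 ^ (n ∸ t)                 ∎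
  where
  open ≡-Reasoning
  t = suc (suc k)

-- s ≥ 2 and the largest letter recurs

-- Positions t are 1-indexed.
deleteAt : ℕ → List ℕ → List ℕ
deleteAt t π = take (t ∸ 1) π ++ drop t π

insertMaxAt : ℕ → List ℕ → List ℕ
insertMaxAt t σ = take (t ∸ 1) σ ++ maxL σ ∷ drop (t ∸ 1) σ

deleteAt-++ : ∀ xs {m ys k} → length xs ≡ k → deleteAt (suc k) (xs ++ m ∷ ys) ≡ xs ++ ys
deleteAt-++ xs {m} {ys} |xs|≡k = cong₂ _++_ (take-++-length xs (m ∷ ys) |xs|≡k) (drop-++-∷ xs |xs|≡k)

insertMaxAt-++ : ∀ xs {ys k} → length xs ≡ k → insertMaxAt (suc k) (xs ++ ys) ≡ xs ++ maxL (xs ++ ys) ∷ ys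
insertMaxAt-++ xs {ys} |xs|≡k = cong₂ _++_ (take-++-length xs ys |xs|≡k) (cong (_ ∷_) (drop-++-length xs ys |xs|≡k))

-- Position of the second occurrence of the largest letter once the first one, at t, is deleted; 0 if there is none.
nextMax : ℕ → List ℕ → ℕ
nextMax t π = firstOcc (maxL π) (deleteAt t π)

deleteAt-shapeWord : ∀ c u v y → deleteAt (suc (length u + suc (length v))) (shapeWord c u v y) ≡ (u ++ c ∷ v) ++ y
deleteAt-shapeWord c u v y =
  trans (cong (deleteAt (suc (length u + suc (length v)))) (sym (shapeWord-assoc c u v y))) (deleteAt-++ (u ++ c ∷ v) (length-++ u))

nextMax-shapeWord : ∀ {c u v y} → Shaped c u v y →
  nextMax (suc (length u + suc (length v))) (shapeWord c u v y) ≡ firstOcc (suc c) ((u ++ c ∷ v) ++ y)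
nextMax-shapeWord {c} {u} {v} {y} sh = cong₂ firstOcc (Shaped-properties.maxL≡ sh) (deleteAt-shapeWord c u v y)

Shaped-nextMax≢0 : ∀ {c u v y} → Shaped c u v y → nextMax (suc (length u + suc (length v))) (shapeWord c u v y) ≢ 0 → suc c ∈ y
Shaped-nextMax≢0 {c} {u} {v} {y} sh next≢0 with ∈-++⁻ (u ++ c ∷ v) (firstOcc≢0⇒∈ ((u ++ c ∷ v) ++ y) (next≢0 ∘ trans (nextMax-shapeWord sh)))
... | inj₁ c+1∈x = contradiction c+1∈x (Shaped-properties.c+1∉u++c∷v sh)
... | inj₂ c+1∈y = c+1∈y

Shaped-nextMax≡0 : ∀ {c u v y} → Shaped c u v y → nextMax (suc (length u + suc (length v))) (shapeWord c u v y) ≡ 0 → suc c ∉ y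
Shaped-nextMax≡0 {c} {u} {v} {y} sh next≡0 c+1∈y =
  firstOcc≡0⇒∉ ((u ++ c ∷ v) ++ y) (trans (sym (nextMax-shapeWord sh)) next≡0) (∈-++⁺ʳ (u ++ c ∷ v) c+1∈y)

Shaped-deleteFirstMax : ∀ {c u v₁ v₂ y} → Shaped c u v₁ (v₂ ++ suc c ∷ y) → suc c ∉ v₂ → Shaped c u (v₁ ++ v₂) y
Shaped-deleteFirstMax {c} {u} {v₁} {v₂} {y} sh c+1∉v₂ = record
  { 1≤c = 1≤c
  ; bounded = subst (All (_≤ suc c)) σ≡ (All.++⁺ (All.++⁻ˡ x bounded′) (All.tail (All.++⁻ʳ x bounded′)))
  ; c∉u = c∉u
  ; c+1∉u = c+1∉u
  ; c+1∉v = ∉-++⁺ v₁ c+1∉v c+1∉v₂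
  ; rgf = subst (RGFFrom 0) σ≡ (RGFFrom-++-full x (proj₁ (RGFFrom-++⁻ x rgf′))
            (All.zip ( All.tail (All.++⁻ʳ x (RGFFrom-positive rgf′))
                     , All.map (λ ≤c+1 → ≤-trans ≤c+1 (s≤s (≤-maxL x (∈-++⁺ʳ u (here refl))))) (All.tail (All.++⁻ʳ x bounded′)))))
  ; avoids = avoids ∘ subst Contains12123 (shapeWord-assoc c u v₁ z)
             ∘ Contains12123-mono (++⁺ (⊆-refl {x = x}) (suc c ∷ʳ ⊆-refl)) ∘ subst Contains12123 (sym σ≡) }
  where
  open Shaped sh
  x = u ++ c ∷ v₁
  z = v₂ ++ suc c ∷ y
  σ≡ : x ++ z ≡ shapeWord c u (v₁ ++ v₂) y
  σ≡ = sym (shapeWord-++ c u v₁ v₂ y)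
  bounded′ : All (_≤ suc c) (x ++ suc c ∷ z)
  bounded′ = subst (All (_≤ suc c)) (sym (shapeWord-assoc c u v₁ z)) bounded
  rgf′ : RGFFrom 0 (x ++ suc c ∷ z)
  rgf′ = subst (RGFFrom 0) (sym (shapeWord-assoc c u v₁ z)) rgf

Shaped-insertFirstMax : ∀ {c u v₁ v₂ y} → Shaped c u (v₁ ++ v₂) y → Shaped c u v₁ (v₂ ++ suc c ∷ y)
Shaped-insertFirstMax {c} {u} {v₁} {v₂} {y} sh = record
  { 1≤c = 1≤c
  ; bounded = subst (All (_≤ suc c)) π≡ bounded′
  ; c∉u = c∉u
  ; c+1∉u = c+1∉u
  ; c+1∉v = c+1∉v ∘ ∈-++⁺ˡ
  ; rgf = subst (RGFFrom 0) π≡ (RGFFrom-++-full x (proj₁ (RGFFrom-++⁻ x rgf′))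
            (All.zip ( s≤s z≤n ∷ All.++⁻ʳ x (RGFFrom-positive rgf′)
                     , All.map (λ ≤c+1 → ≤-trans ≤c+1 (s≤s (≤-maxL x (∈-++⁺ʳ u (here refl))))) (All.++⁻ʳ x bounded′))))
  ; avoids = avoids ∘ subst Contains12123 σ≡
             ∘ Contains12123-dropRepeatedMax x bounded′ (∈-++⁺ʳ v₂ (here refl)) ∘ subst Contains12123 (sym π≡) }
  where
  open Shaped sh
  x = u ++ c ∷ v₁
  z = v₂ ++ suc c ∷ y
  π≡ : x ++ suc c ∷ z ≡ shapeWord c u v₁ z
  π≡ = shapeWord-assoc c u v₁ z
  σ≡ : x ++ z ≡ shapeWord c u (v₁ ++ v₂) y
  σ≡ = sym (shapeWord-++ c u v₁ v₂ y)
  bounded′ : All (_≤ suc c) (x ++ suc c ∷ z)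
  bounded′ = let b = subst (All (_≤ suc c)) (sym σ≡) bounded in All.++⁺ (All.++⁻ˡ x b) (≤-refl ∷ All.++⁻ʳ x b)
  rgf′ : RGFFrom 0 (x ++ z)
  rgf′ = subst (RGFFrom 0) (sym σ≡) rgf

RecursAt : ℕ → ℕ → ℕ → List ℕ → Set
RecursAt t s j π = (T (inA t s π) × nextMax t π ≢ 0) × nextMax t π ≡ j

RecursAt? : ∀ t s j → Decidable (RecursAt t s j)
RecursAt? t s j = (inA? t s ∩? ∁? (λ π → nextMax t π ≟ 0)) ∩? (λ π → nextMax t π ≟ j)

deleteMax-forward : ∀ {n t s j π} → π ∈ words n n → RecursAt t s j π →
  (deleteAt t π ∈ words (n ∸ 1) (n ∸ 1) × T (inA j s (deleteAt t π))) × insertMaxAt t (deleteAt t π) ≡ π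
deleteMax-forward {n} {t} {s} {j} {π} π∈ ((π∈A , next≢0) , next≡j)
  with InA⇒Shape π (Equivalence.to (T-inA⇔InA π) π∈A)
... | shape {c} {u} {v} {y} refl sh refl refl with ∈-splitFirst y (Shaped-nextMax≢0 sh next≢0)
...   | y₁ , y₂ , refl , c+1∉y₁ = subst Goal (sym σ≡) ((subst (_∈ words (n ∸ 1) (n ∸ 1)) (sym σ≡′) σ∈ , σ∈A) , inverse)
  where
  x = u ++ c ∷ v
  Goal : List ℕ → Set
  Goal σ = (σ ∈ words (n ∸ 1) (n ∸ 1) × T (inA j s σ)) × insertMaxAt t σ ≡ shapeWord c u v (y₁ ++ suc c ∷ y₂)
  σ≡ : deleteAt t (shapeWord c u v (y₁ ++ suc c ∷ y₂)) ≡ x ++ y₁ ++ suc c ∷ y₂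
  σ≡ = deleteAt-shapeWord c u v _
  sh′ = Shaped-deleteFirstMax sh c+1∉y₁
  σ≡′ : x ++ y₁ ++ suc c ∷ y₂ ≡ shapeWord c u (v ++ y₁) y₂
  σ≡′ = sym (shapeWord-++ c u v y₁ y₂)
  σ∈A : T (inA j s (x ++ y₁ ++ suc c ∷ y₂))
  σ∈A = Equivalence.from (T-inA⇔InA _) (subst₂ (λ j′ σ → InA j′ s σ) j≡ (sym σ≡′) (Shaped-properties.InA-shapeWord sh′))
    where
    j≡ : suc (length u + suc (length (v ++ y₁))) ≡ j
    j≡ = trans (sym (Shaped-properties.firstOcc-c+1 sh′))
           (trans (cong (firstOcc (suc c)) (sym σ≡′)) (trans (sym (nextMax-shapeWord sh)) next≡j))
  σ∈ : shapeWord c u (v ++ y₁) y₂ ∈ words (n ∸ 1) (n ∸ 1)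
  σ∈ = RGFFrom⇒∈words (Shaped.rgf sh′) (trans (cong length (sym σ≡′)) (cong (_∸ 1) (begin
    suc (length (x ++ y₁ ++ suc c ∷ y₂))  ≡⟨ length-++-∷ x ⟨
    length (x ++ suc c ∷ y₁ ++ suc c ∷ y₂) ≡⟨ cong length (shapeWord-assoc c u v _) ⟩
    length (shapeWord c u v (y₁ ++ suc c ∷ y₂)) ≡⟨ proj₁ (∈-words⁻ {n} {n} π∈) ⟩
    n                                     ∎)))
    where open ≡-Reasoning
  inverse : insertMaxAt t (x ++ y₁ ++ suc c ∷ y₂) ≡ shapeWord c u v (y₁ ++ suc c ∷ y₂)
  inverse = trans (insertMaxAt-++ x (length-++ u))
    (trans (cong (λ m → x ++ m ∷ _) (trans (cong maxL σ≡′) (Shaped-properties.maxL≡ sh′))) (shapeWord-assoc c u v _))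

deleteMax-backward : ∀ {n t s j σ} → 1 ≤ n → s < t → t ≤ j → σ ∈ words (n ∸ 1) (n ∸ 1) → T (inA j s σ) →
  (insertMaxAt t σ ∈ words n n × RecursAt t s j (insertMaxAt t σ)) × deleteAt t (insertMaxAt t σ) ≡ σ
deleteMax-backward {n} {t} {s} {j} {σ} 1≤n s<t t≤j σ∈ σ∈A
  with InA⇒Shape σ (Equivalence.to (T-inA⇔InA σ) σ∈A)
... | shape {c} {u} {v′} {y} refl sh refl refl
  with splitAt-length (t ∸ suc (suc (length u))) v′ k≤|v′|
  where
  k≤|v′| : t ∸ suc (suc (length u)) ≤ length v′
  k≤|v′| = subst (t ∸ suc (suc (length u)) ≤_)
    (trans (cong (_∸ suc (length u)) (+-suc (length u) (length v′))) (m+n∸m≡n (suc (length u)) (length v′)))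
    (∸-monoˡ-≤ (suc (suc (length u))) t≤j)
... | v₁ , v₂ , refl , |v₁|≡ with t≡
  where
  t≡ : t ≡ suc (length u + suc (length v₁))
  t≡ = sym (trans (cong suc (trans (+-suc (length u) (length v₁)) (cong (λ k → suc (length u + k)) |v₁|≡))) (m+[n∸m]≡n s<t))
... | refl = subst Goal (sym π≡) ((π∈ , (π∈A , next≢0) , next≡j) , trans deleted (sym σ≡))
  where
  x = u ++ c ∷ v₁
  z = v₂ ++ suc c ∷ y
  Goal : List ℕ → Set
  Goal π = (π ∈ words n n × RecursAt t s j π) × deleteAt t π ≡ σ
  sh′ = Shaped-insertFirstMax sh
  σ≡ : σ ≡ x ++ z
  σ≡ = shapeWord-++ c u v₁ v₂ y
  π≡ : insertMaxAt t σ ≡ x ++ suc c ∷ z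
  π≡ = trans (cong (insertMaxAt t) σ≡)
    (trans (insertMaxAt-++ x (length-++ u)) (cong (λ m → x ++ m ∷ z) (trans (cong maxL (sym σ≡)) (Shaped-properties.maxL≡ sh))))
  deleted : deleteAt t (x ++ suc c ∷ z) ≡ x ++ z
  deleted = deleteAt-++ x (length-++ u)
  π∈ : x ++ suc c ∷ z ∈ words n n
  π∈ = RGFFrom⇒∈words (subst (RGFFrom 0) (sym (shapeWord-assoc c u v₁ z)) (Shaped.rgf sh′)) (begin
    length (x ++ suc c ∷ z)  ≡⟨ length-++-∷ x ⟩
    suc (length (x ++ z))    ≡⟨ cong (suc ∘ length) σ≡ ⟨
    suc (length σ)           ≡⟨ cong suc (proj₁ (∈-words⁻ {n ∸ 1} {n ∸ 1} σ∈)) ⟩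
    suc (n ∸ 1)              ≡⟨ m+[n∸m]≡n 1≤n ⟩
    n                        ∎)
    where open ≡-Reasoning
  π∈A : T (inA t s (x ++ suc c ∷ z))
  π∈A = Equivalence.from (T-inA⇔InA _) (subst (InA t s) (sym (shapeWord-assoc c u v₁ z)) (Shaped-properties.InA-shapeWord sh′))
  next≡j : nextMax t (x ++ suc c ∷ z) ≡ j
  next≡j = trans (cong₂ firstOcc (trans (cong maxL (shapeWord-assoc c u v₁ z)) (Shaped-properties.maxL≡ sh′)) deleted)
                 (trans (cong (firstOcc (suc c)) (sym σ≡)) (Shaped-properties.firstOcc-c+1 sh))
  next≢0 : nextMax t (x ++ suc c ∷ z) ≢ 0
  next≢0 next≡0 = 1+n≢0 (trans (sym next≡j) next≡0)

count-RecursAt : ∀ n t s j → 1 ≤ n → s < t → t ≤ j → count (RecursAt? t s j) (words n n) ≡ a (n ∸ 1) j s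
count-RecursAt n t s j 1≤n s<t t≤j =
  count-bijection (RecursAt? t s j) (inA? j s) (words-unique n n) (words-unique (n ∸ 1) (n ∸ 1))
    (deleteAt t) (insertMaxAt t) (deleteMax-forward {n}) (deleteMax-backward 1≤n s<t t≤j)

nextMax-bounds : ∀ {n t s π} → π ∈ words n n → T (inA t s π) → nextMax t π ≢ 0 → t ≤ nextMax t π × nextMax t π ≤ n ∸ 1
nextMax-bounds {n} {t} {s} {π} π∈ π∈A next≢0 with InA⇒Shape π (Equivalence.to (T-inA⇔InA π) π∈A)
... | shape {c} {u} {v} {y} refl sh refl refl =
  subst (t ≤_) (sym next≡) t≤ , subst (_≤ n ∸ 1) (sym next≡) (subst (length x + firstOcc (suc c) y ≤_) |x++y|≡ (+-monoʳ-≤ (length x) first≤))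
  where
  x = u ++ c ∷ v
  c+1∈y : suc c ∈ y
  c+1∈y = Shaped-nextMax≢0 sh next≢0
  next≡ : nextMax t (shapeWord c u v y) ≡ length x + firstOcc (suc c) y
  next≡ = trans (nextMax-shapeWord sh) (firstOcc-++ʳ x y (Shaped-properties.c+1∉u++c∷v sh) c+1∈y)
  1≤first = proj₁ (firstOcc-bounds y c+1∈y)
  first≤ = proj₂ (firstOcc-bounds y c+1∈y)
  t≤ : suc (length u + suc (length v)) ≤ length x + firstOcc (suc c) y
  t≤ = begin
    suc (length u + suc (length v))  ≡⟨ cong suc (length-++ u) ⟨
    suc (length x)                   ≡⟨ +-comm 1 (length x) ⟩
    length x + 1                     ≤⟨ +-monoʳ-≤ (length x) 1≤first ⟩
    length x + firstOcc (suc c) y    ∎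
    where open ≤-Reasoning
  |x++y|≡ : length x + length y ≡ n ∸ 1
  |x++y|≡ = cong (_∸ 1) (begin
    suc (length x + length y)  ≡⟨ cong suc (length-++ x) ⟨
    suc (length (x ++ y))      ≡⟨ length-++-∷ x ⟨
    length (x ++ suc c ∷ y)    ≡⟨ cong length (shapeWord-assoc c u v y) ⟩
    length (shapeWord c u v y) ≡⟨ proj₁ (∈-words⁻ {n} {n} π∈) ⟩
    n                          ∎)
    where open ≡-Reasoning

count-recurring : ∀ n t s → s < t → t ≤ n →
  count (inA? t s ∩? ∁? (λ π → nextMax t π ≟ 0)) (words n n) ≡ sumFT t (n ∸ 1) (λ j → a (n ∸ 1) j s)
count-recurring n t s s<t t≤n = trans
  (count-partition (inA? t s ∩? ∁? (λ π → nextMax t π ≟ 0)) (nextMax t) t (n ∸ 1) (words n n)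
    (λ {π} π∈ (π∈A , next≢0) → nextMax-bounds {n} {t} {s} {π} π∈ π∈A next≢0))
  (sumFT-cong t (n ∸ 1) (λ j t≤j _ → count-RecursAt n t s j (≤-trans (≤-trans (s≤s z≤n) s<t) t≤n) s<t t≤j))

-- s ≥ 2 and the largest letter occurs once

run : ℕ → List ℕ → ℕ
run c [] = 0
run c (x ∷ xs) with x ≟ c
... | yes _ = suc (run c xs)
... | no _ = 0

HeadNot : ℕ → List ℕ → Set
HeadNot c [] = ⊤
HeadNot c (x ∷ _) = x ≢ c

run-replicate : ∀ c k xs → run c (replicate k c ++ xs) ≡ k + run c xs
run-replicate c zero xs = refl
run-replicate c (suc k) xs with c ≟ c
... | yes _ = cong suc (run-replicate c k xs)
... | no c≢c = contradiction refl c≢c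

run-HeadNot : ∀ c xs {d ys} → HeadNot c xs → d ≢ c → run c (xs ++ d ∷ ys) ≡ 0
run-HeadNot c [] {d} _ d≢c with d ≟ c
... | yes d≡c = contradiction d≡c d≢c
... | no _ = refl
run-HeadNot c (x ∷ xs) x≢c _ with x ≟ c
... | yes x≡c = contradiction x≡c x≢c
... | no _ = refl

run-split : ∀ c v → ∃[ k ] ∃[ δ ] v ≡ replicate k c ++ δ × HeadNot c δ
run-split c [] = 0 , [] , refl , _
run-split c (x ∷ v) with x ≟ c
... | yes refl = let (k , δ , v≡ , headNot) = run-split x v in suc k , δ , cong (x ∷_) v≡ , headNot
... | no x≢c = 0 , x ∷ v , refl , x≢c

∉⇒HeadNot : ∀ {c} xs → c ∉ xs → HeadNot c xs
∉⇒HeadNot [] _ = _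
∉⇒HeadNot (x ∷ xs) c∉ x≡c = c∉ (here (sym x≡c))

-- For a member of A_{n,t,s} with s ≥ 2: the length of the run of second largest letters starting at s,
-- and the first position of the value below the second largest one.
runAt : ℕ → List ℕ → ℕ
runAt s π = suc (run (maxL π ∸ 1) (drop s π))

firstBelowSecond : List ℕ → ℕ
firstBelowSecond π = firstOcc (maxL π ∸ 2) π

-- u c^r δ (c+1) y ↦ u δ c y, where |u| = s - 1 and |u c^r δ| = t - 1
removeRun : ℕ → ℕ → ℕ → List ℕ → List ℕ
removeRun t s r π = take (s ∸ 1) π ++ drop (s ∸ 1 + r) (take (t ∸ 1) π) ++ (maxL π ∸ 1) ∷ drop t π

-- u δ c y ↦ u c^r δ (c+1) y, where |u| = s - 1 and |u δ| = t - r - 1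
insertRun : ℕ → ℕ → ℕ → List ℕ → List ℕ
insertRun t s r σ = take (s ∸ 1) σ ++ replicate r (maxL σ) ++ drop (s ∸ 1) (take (t ∸ r ∸ 1) σ) ++ suc (maxL σ) ∷ drop (t ∸ r) σ

removeRun-++ : ∀ u r δ y {c} → maxL (u ++ replicate r c ++ δ ++ suc c ∷ y) ≡ suc c →
  removeRun (suc (length u + (r + length δ))) (suc (length u)) r (u ++ replicate r c ++ δ ++ suc c ∷ y) ≡ u ++ δ ++ c ∷ y
removeRun-++ u r δ y {c} max≡ = cong₂ _++_ (take-++-length u _ refl) (cong₂ _++_ middle (cong₂ _∷_ (cong (_∸ 1) max≡) suffix))
  where
  c^r = replicate r c
  x = u ++ c^r ++ δ
  |x|≡ : length x ≡ length u + (r + length δ)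
  |x|≡ = trans (length-++ u) (cong (length u +_) (trans (length-++ c^r) (cong (_+ length δ) (length-replicate r))))
  π≡ : x ++ suc c ∷ y ≡ u ++ c^r ++ δ ++ suc c ∷ y
  π≡ = trans (++-assoc u (c^r ++ δ) (suc c ∷ y)) (cong (u ++_) (++-assoc c^r δ (suc c ∷ y)))
  middle : drop (length u + r) (take (length u + (r + length δ)) (u ++ c^r ++ δ ++ suc c ∷ y)) ≡ δ
  middle = begin
    drop (length u + r) (take (length u + (r + length δ)) (u ++ c^r ++ δ ++ suc c ∷ y))
      ≡⟨ cong (drop (length u + r)) (trans (cong (take _) (sym π≡)) (take-++-length x (suc c ∷ y) |x|≡)) ⟩
    drop (length u + r) (u ++ c^r ++ δ)   ≡⟨ cong (drop (length u + r)) (++-assoc u c^r δ) ⟨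
    drop (length u + r) ((u ++ c^r) ++ δ) ≡⟨ drop-++-length (u ++ c^r) δ (trans (length-++ u) (cong (length u +_) (length-replicate r))) ⟩
    δ                                     ∎
    where open ≡-Reasoning
  suffix : drop (suc (length u + (r + length δ))) (u ++ c^r ++ δ ++ suc c ∷ y) ≡ y
  suffix = trans (cong (drop (suc (length u + (r + length δ)))) (sym π≡)) (drop-++-∷ x |x|≡)

insertRun-++ : ∀ t u r δ y {c} → maxL (u ++ δ ++ c ∷ y) ≡ c → t ∸ r ≡ suc (length u + length δ) →
  insertRun t (suc (length u)) r (u ++ δ ++ c ∷ y) ≡ u ++ replicate r c ++ δ ++ suc c ∷ y
insertRun-++ t u r δ y {c} max≡ t∸r≡ rewrite max≡ | t∸r≡ =
  cong₂ _++_ (take-++-length u _ refl) (cong (replicate r c ++_) (cong₂ _++_ middle (cong (suc c ∷_) suffix)))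
  where
  σ≡ : (u ++ δ) ++ c ∷ y ≡ u ++ δ ++ c ∷ y
  σ≡ = ++-assoc u δ (c ∷ y)
  middle : drop (length u) (take (length u + length δ) (u ++ δ ++ c ∷ y)) ≡ δ
  middle = trans (cong (drop (length u)) (trans (cong (take _) (sym σ≡)) (take-++-length (u ++ δ) (c ∷ y) (length-++ u)))) (drop-++-length u δ refl)
  suffix : drop (suc (length u + length δ)) (u ++ δ ++ c ∷ y) ≡ y
  suffix = trans (cong (drop (suc (length u + length δ))) (sym σ≡)) (drop-++-∷ (u ++ δ) (length-++ u))

runWord≡ : ∀ C u k δ y → shapeWord C u (replicate k C ++ δ) y ≡ u ++ replicate (suc k) C ++ δ ++ suc C ∷ y
runWord≡ C u k δ y = cong (λ w → u ++ C ∷ w) (++-assoc (replicate k C) δ (suc C ∷ y))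

runWord-assoc : ∀ C u k δ y → (u ++ replicate (suc k) C ++ δ) ++ suc C ∷ y ≡ shapeWord C u (replicate k C ++ δ) y
runWord-assoc C u k δ y = trans (++-assoc u (replicate (suc k) C ++ δ) (suc C ∷ y))
  (trans (cong (u ++_) (++-assoc (replicate (suc k) C) δ (suc C ∷ y))) (sym (runWord≡ C u k δ y)))

-- After the run c^(k+1) that starts at position s, the second largest letter c does not recur:
-- a letter h < c ending the run already occurs in u, and a later c would complete h c h c (c+1).
Shaped-afterRun : ∀ {c u k δ y} → Shaped c u (replicate k c ++ δ) y → HeadNot c δ → c ∉ δ
Shaped-afterRun {δ = []} _ _ ()
Shaped-afterRun {c} {u} {k} {h ∷ δ′} {y} sh h≢c (here c≡h) = h≢c (sym c≡h)
Shaped-afterRun {c} {u} {k} {h ∷ δ′} {y} sh h≢c (there c∈δ′) = avoids (h , c , suc c , h<c , n<1+n c , hchc⊆)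
  where
  open Shaped sh
  open Shaped-properties sh
  h<c : h < c
  h<c = ≤∧≢⇒< (All.head (All.++⁻ʳ (replicate k c) v≤c)) h≢c
  1≤h : 1 ≤ h
  1≤h = All.head (All.++⁻ʳ (replicate k c) (All.++⁻ˡ (replicate k c ++ h ∷ δ′) (All.tail (All.++⁻ʳ u (RGFFrom-positive rgf)))))
  h∈u : h ∈ u
  h∈u with RGFFrom-attains u (proj₁ (RGFFrom-++⁻ u rgf)) 1≤h (≤-pred (≤-trans h<c c≤1+maxL-u))
  ... | inj₁ h≤0 = contradiction (≤-trans 1≤h h≤0) λ ()
  ... | inj₂ h∈u = h∈u
  hchc⊆ : pattern12123 h c (suc c) ⊆ shapeWord c u (replicate k c ++ h ∷ δ′) y
  hchc⊆ = ++⁺ (from∈ h∈u) (refl ∷ subst (h ∷ c ∷ suc c ∷ [] ⊆_) (sym (++-assoc (replicate k c) (h ∷ δ′) (suc c ∷ y)))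
              (++⁺ˡ (replicate k c) (refl ∷ ++⁺ (from∈ c∈δ′) (refl ∷ minimum y))))

Shaped-lower : ∀ {c u₁ w k δ y} → 1 ≤ c → c ∉ u₁ → Shaped (suc c) (u₁ ++ c ∷ w) (replicate k (suc c) ++ δ) y →
  suc c ∉ δ → suc (suc c) ∉ y → Shaped c u₁ (w ++ δ) y
Shaped-lower {c} {u₁} {w} {k} {δ} {y} 1≤c′ c∉u₁ sh C∉δ C+1∉y = record
  { 1≤c = 1≤c′
  ; bounded = subst (All (_≤ C)) σ≡ σ≤C
  ; c∉u = c∉u₁
  ; c+1∉u = All<⇒∉ (All.++⁻ˡ u₁ u<c)
  ; c+1∉v = ∉-++⁺ w (All<⇒∉ (All.tail (All.++⁻ʳ u₁ u<c))) C∉δ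
  ; rgf = subst (RGFFrom 0) σ≡ (RGFFrom-++-full u (proj₁ (RGFFrom-++⁻ u rgf))
            (All.zip ( All.++⁺ (All.++⁻ˡ δ positive) (s≤s z≤n ∷ All.tail (All.++⁻ʳ δ positive))
                     , All.map (λ ≤C → ≤-trans ≤C (s≤s c≤maxL-u)) (All.++⁻ʳ u σ≤C))))
  ; avoids = avoids ∘ subst Contains12123 π≡
             ∘ Contains12123-raiseMax (u ++ δ) (subst (All (_≤ C)) (sym (++-assoc u δ (C ∷ y))) σ≤C)
                 (++⁺ (⊆-refl {x = u}) (++⁺ˡ C^r ⊆-refl))
             ∘ subst Contains12123 (sym (trans (++-assoc u δ (C ∷ y)) σ≡)) }
  where
  C = suc c
  u = u₁ ++ c ∷ w
  C^r = replicate (suc k) C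
  open Shaped sh using (rgf; avoids)
  open Shaped-properties sh using (u<c; v≤c)
  σ≡ : u ++ δ ++ C ∷ y ≡ shapeWord c u₁ (w ++ δ) y
  σ≡ = sym (shapeWord-++ c u₁ w δ y)
  π≡ : (u ++ C^r ++ δ) ++ suc C ∷ y ≡ shapeWord C u (replicate k C ++ δ) y
  π≡ = runWord-assoc C u k δ y
  δ<C : All (_< C) δ
  δ<C = All≤∧∉⇒All< (All.++⁻ʳ (replicate k C) v≤c) C∉δ
  y≤C : All (_≤ C) y
  y≤C = All≤suc⇒All≤ (Shaped-properties.y≤c+1 sh) C+1∉y
  σ≤C : All (_≤ C) (u ++ δ ++ C ∷ y)
  σ≤C = All.++⁺ (All.map <⇒≤ u<c) (All.++⁺ (All.map <⇒≤ δ<C) (≤-refl ∷ y≤C))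
  positive : All (1 ≤_) (δ ++ suc C ∷ y)
  positive = All.++⁻ʳ (replicate k C) (subst (All (1 ≤_)) (++-assoc (replicate k C) δ (suc C ∷ y)) (All.tail (All.++⁻ʳ u (RGFFrom-positive rgf))))
  c≤maxL-u : c ≤ maxL u
  c≤maxL-u = ≤-maxL u (∈-++⁺ʳ u₁ (here refl))

Shaped-raise : ∀ {c u₁ w k δ y} → Shaped c u₁ (w ++ δ) y → Shaped (suc c) (u₁ ++ c ∷ w) (replicate k (suc c) ++ δ) y
Shaped-raise {c} {u₁} {w} {k} {δ} {y} sh = record
  { 1≤c = s≤s z≤n
  ; bounded = subst (All (_≤ suc C)) (sym (runWord≡ C u k δ y))
      (All.++⁺ (All.map m≤n⇒m≤1+n u≤C)
        (All.++⁺ (All.replicate⁺ (suc k) (n≤1+n C)) (All.++⁺ (All.map m≤n⇒m≤1+n δ≤C) (≤-refl ∷ All.map m≤n⇒m≤1+n y≤C))))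
  ; c∉u = C∉u
  ; c+1∉u = All≤⇒∉suc u≤C
  ; c+1∉v = All≤⇒∉suc (All.++⁺ (All.replicate⁺ k ≤-refl) δ≤C)
  ; rgf = subst (RGFFrom 0) (runWord-assoc C u k δ y) (RGFFrom-++-full (u ++ C^r ++ δ) rgf-prefix
            (All.zip (s≤s z≤n ∷ All.tail (All.++⁻ʳ δ positive) , s≤s C≤max ∷ All.map (λ ≤C → ≤-trans ≤C (m≤n⇒m≤1+n C≤max)) y≤C)))
  ; avoids = avoids ∘ subst Contains12123 (sym σ≡)
             ∘ Contains12123-lowerMax u (suc k) δ u<C δ<C y≤C ∘ subst Contains12123 (runWord≡ C u k δ y) }
  where
  C = suc c
  u = u₁ ++ c ∷ w
  C^r = replicate (suc k) C
  open Shaped sh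
  σ≡ : shapeWord c u₁ (w ++ δ) y ≡ u ++ δ ++ C ∷ y
  σ≡ = shapeWord-++ c u₁ w δ y
  σ≤C : All (_≤ C) (u ++ δ ++ C ∷ y)
  σ≤C = subst (All (_≤ C)) σ≡ bounded
  u≤C : All (_≤ C) u
  u≤C = All.++⁻ˡ u σ≤C
  C∉u : C ∉ u
  C∉u = ∉-++⁺ u₁ c+1∉u λ { (here C≡c) → 1+n≢n C≡c ; (there C∈w) → c+1∉v (∈-++⁺ˡ C∈w) }
  u<C : All (_< C) u
  u<C = All≤∧∉⇒All< u≤C C∉u
  δ≤C : All (_≤ C) δ
  δ≤C = All.++⁻ˡ δ (All.++⁻ʳ u σ≤C)
  δ<C : All (_< C) δ
  δ<C = All≤∧∉⇒All< δ≤C (c+1∉v ∘ ∈-++⁺ʳ w)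
  y≤C : All (_≤ C) y
  y≤C = All.tail (All.++⁻ʳ δ (All.++⁻ʳ u σ≤C))
  rgf′ : RGFFrom 0 (u ++ δ ++ C ∷ y)
  rgf′ = subst (RGFFrom 0) σ≡ rgf
  positive : All (1 ≤_) (δ ++ C ∷ y)
  positive = All.++⁻ʳ u (RGFFrom-positive rgf′)
  rgf-prefix : RGFFrom 0 (u ++ C^r ++ δ)
  rgf-prefix = RGFFrom-++-full u (proj₁ (RGFFrom-++⁻ u rgf′))
    (All.zip ( All.++⁺ (All.replicate⁺ (suc k) (s≤s z≤n)) (All.++⁻ˡ δ positive)
             , All.map (λ ≤C → ≤-trans ≤C (s≤s (≤-maxL u (∈-++⁺ʳ u₁ (here refl))))) (All.++⁺ (All.replicate⁺ (suc k) ≤-refl) δ≤C)))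
  C≤max : C ≤ maxL (u ++ C^r ++ δ)
  C≤max = ≤-maxL (u ++ C^r ++ δ) (∈-++⁺ʳ u (here refl))

-- An RGF starts with 1, so a second largest letter absent from a nonempty u is at least 2.
Shaped-2≤c : ∀ {c u v y} → Shaped c u v y → 1 ≤ length u → 2 ≤ c
Shaped-2≤c {u = h ∷ _} sh _ with Shaped.rgf sh
... | grow 1≤h h≤1 _ = ≤∧≢⇒< (Shaped.1≤c sh) (λ 1≡c → Shaped.c∉u sh (here (trans (sym 1≡c) (sym (≤-antisym h≤1 1≤h)))))

Shaped-c∈u : ∀ {c u v y} → Shaped (suc c) u v y → 1 ≤ c → c ∈ u
Shaped-c∈u {c} {u} sh 1≤c = subst (_∈ u) maxL-u≡c (maxL-∈ u (subst (1 ≤_) (sym maxL-u≡c) 1≤c))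
  where
  open Shaped-properties sh
  maxL-u≡c : maxL u ≡ c
  maxL-u≡c = ≤-antisym (maxL-lub u (All.map ≤-pred u<c)) (≤-pred c≤1+maxL-u)

-- A member π = u c^(k+1) δ (c+2) y of A_{n,t,s} (writing c + 1 for its second largest letter) whose
-- largest letter occurs once, and its image σ = u δ (c+1) y, where u = u₁ c w and c ∉ u₁.
module RunCorrespondence {c u₁ w k δ y} (1≤c : 1 ≤ c) (c∉u₁ : c ∉ u₁) (c+1∉δ : suc c ∉ δ) (c+2∉y : suc (suc c) ∉ y)
  (shπ : Shaped (suc c) (u₁ ++ c ∷ w) (replicate k (suc c) ++ δ) y) where

  C = suc c
  u = u₁ ++ c ∷ w
  r = suc k
  π = u ++ replicate r C ++ δ ++ suc C ∷ y
  σ = u ++ δ ++ C ∷ y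
  t = suc (length u + (r + length δ))
  s = suc (length u)
  i = suc (length u₁)

  shσ : Shaped c u₁ (w ++ δ) y
  shσ = Shaped-lower 1≤c c∉u₁ shπ c+1∉δ c+2∉y

  σ≡ : σ ≡ shapeWord c u₁ (w ++ δ) y
  σ≡ = sym (shapeWord-++ c u₁ w δ y)

  maxL-π : maxL π ≡ suc C
  maxL-π = trans (cong maxL (sym (runWord≡ C u k δ y))) (Shaped-properties.maxL≡ shπ)

  maxL-σ : maxL σ ≡ C
  maxL-σ = trans (cong maxL σ≡) (Shaped-properties.maxL≡ shσ)

  |Cᵏδ|≡ : length (replicate k C ++ δ) ≡ k + length δ
  |Cᵏδ|≡ = trans (length-++ (replicate k C)) (cong (_+ length δ) (length-replicate k))

  t∸r≡ : t ∸ r ≡ suc (length u + length δ)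
  t∸r≡ = trans (cong (_∸ r) (shift (length u) k (length δ))) (m+n∸m≡n r (suc (length u + length δ)))
    where
    shift : ∀ a k d → suc (a + (suc k + d)) ≡ suc k + suc (a + d)
    shift = solve-∀

  |π|≡ : length π ≡ r + length σ
  |π|≡ = begin
    length π                                           ≡⟨ length-++ u ⟩
    length u + length (replicate r C ++ δ ++ suc C ∷ y) ≡⟨ cong (length u +_) (length-++ (replicate r C)) ⟩
    length u + (length (replicate r C) + length (δ ++ suc C ∷ y))
      ≡⟨ cong₂ (λ l l′ → length u + (l + l′)) (length-replicate r) (length-++ δ) ⟩
    length u + (r + (length δ + suc (length y)))       ≡⟨ swap (length u) r (length δ + suc (length y)) ⟩
    r + (length u + (length δ + suc (length y)))       ≡⟨ cong (λ l → r + (length u + l)) (length-++ δ) ⟨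
    r + (length u + length (δ ++ C ∷ y))               ≡⟨ cong (r +_) (length-++ u) ⟨
    r + length σ                                       ∎
    where
    open ≡-Reasoning
    swap : ∀ a b d → a + (b + d) ≡ b + (a + d)
    swap = solve-∀

  π∈A : T (inA t s π)
  π∈A = Equivalence.from (T-inA⇔InA π) (subst₂ (λ t′ π′ → InA t′ s π′)
          (cong (λ l → suc (length u + suc l)) |Cᵏδ|≡) (runWord≡ C u k δ y) (Shaped-properties.InA-shapeWord shπ))

  nextMax≡0 : nextMax t π ≡ 0
  nextMax≡0 = begin
    firstOcc (maxL π) (deleteAt t π)  ≡⟨ cong₂ firstOcc maxL-π (trans (cong (deleteAt t) (sym π≡x++)) (deleteAt-++ x |x|≡)) ⟩
    firstOcc (suc C) (x ++ y)         ≡⟨ firstOcc-∉ (x ++ y) (∉-++⁺ x C+1∉x c+2∉y) ⟩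
    0                                 ∎
    where
    open ≡-Reasoning
    open Shaped shπ using (c+1∉u; c+1∉v)
    x = u ++ replicate r C ++ δ
    π≡x++ : x ++ suc C ∷ y ≡ π
    π≡x++ = trans (++-assoc u (replicate r C ++ δ) (suc C ∷ y)) (cong (u ++_) (++-assoc (replicate r C) δ (suc C ∷ y)))
    C+1∉x : suc C ∉ x
    C+1∉x = ∉-++⁺ u c+1∉u (∉-++⁺ (replicate r C) (∉-replicate r 1+n≢n) (c+1∉v ∘ ∈-++⁺ʳ (replicate k C)))
    |x|≡ : length x ≡ length u + (r + length δ)
    |x|≡ = trans (length-++ u) (cong (length u +_) (trans (length-++ (replicate r C)) (cong (_+ length δ) (length-replicate r))))

  runAt≡ : runAt s π ≡ r
  runAt≡ = cong suc (begin
    run (maxL π ∸ 1) (drop s π)                          ≡⟨ cong₂ run (cong (_∸ 1) maxL-π) (drop-++-∷ u refl) ⟩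
    run C (replicate k C ++ δ ++ suc C ∷ y)              ≡⟨ run-replicate C k (δ ++ suc C ∷ y) ⟩
    k + run C (δ ++ suc C ∷ y)                           ≡⟨ cong (k +_) (run-HeadNot C δ (∉⇒HeadNot δ c+1∉δ) 1+n≢n) ⟩
    k + 0                                                ≡⟨ +-identityʳ k ⟩
    k                                                    ∎)
    where open ≡-Reasoning

  firstBelowSecond≡ : firstBelowSecond π ≡ i
  firstBelowSecond≡ = trans (cong₂ firstOcc (cong (_∸ 2) maxL-π) (++-assoc u₁ (c ∷ w) _)) (firstOcc-first u₁ _ c∉u₁)

  σ∈A : T (inA (t ∸ r) i σ)
  σ∈A = Equivalence.from (T-inA⇔InA σ) (subst₂ (λ t′ σ′ → InA t′ i σ′) (sym t∸r≡′) (sym σ≡) (Shaped-properties.InA-shapeWord shσ))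
    where
    t∸r≡′ : t ∸ r ≡ suc (length u₁ + suc (length (w ++ δ)))
    t∸r≡′ = begin
      t ∸ r                                       ≡⟨ t∸r≡ ⟩
      suc (length u + length δ)                   ≡⟨ cong (λ l → suc (l + length δ)) (length-++ u₁) ⟩
      suc (length u₁ + suc (length w) + length δ) ≡⟨ cong suc (+-assoc (length u₁) (suc (length w)) (length δ)) ⟩
      suc (length u₁ + suc (length w + length δ)) ≡⟨ cong (λ l → suc (length u₁ + suc l)) (length-++ w) ⟨
      suc (length u₁ + suc (length (w ++ δ)))     ∎
      where open ≡-Reasoning

  σ∈words : ∀ {n} → length π ≡ n → σ ∈ words (n ∸ r) (n ∸ r)
  σ∈words |π|≡n = RGFFrom⇒∈words (subst (RGFFrom 0) (sym σ≡) (Shaped.rgf shσ))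
    (trans (sym (m+n∸m≡n r (length σ))) (cong (_∸ r) (trans (sym |π|≡) |π|≡n)))

  π∈words : ∀ {n} → r ≤ n → length σ ≡ n ∸ r → π ∈ words n n
  π∈words r≤n |σ|≡ = RGFFrom⇒∈words (subst (RGFFrom 0) (runWord≡ C u k δ y) (Shaped.rgf shπ))
    (trans |π|≡ (trans (cong (r +_) |σ|≡) (m+[n∸m]≡n r≤n)))

  removeRun≡ : removeRun t s r π ≡ σ
  removeRun≡ = removeRun-++ u r δ y maxL-π

  insertRun≡ : insertRun t s r σ ≡ π
  insertRun≡ = insertRun-++ t u r δ y maxL-σ t∸r≡

record RunShape (t s : ℕ) (π : List ℕ) : Set where
  constructor runShape
  field
    {c k} : ℕ
    {u₁ w δ y} : List ℕ
    1≤c : 1 ≤ c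
    c∉u₁ : c ∉ u₁
    c+1∉δ : suc c ∉ δ
    c+2∉y : suc (suc c) ∉ y
    shaped : Shaped (suc c) (u₁ ++ c ∷ w) (replicate k (suc c) ++ δ) y
    π≡ : π ≡ (u₁ ++ c ∷ w) ++ replicate (suc k) (suc c) ++ δ ++ suc (suc c) ∷ y
    s≡ : s ≡ suc (length (u₁ ++ c ∷ w))
    t≡ : t ≡ suc (length (u₁ ++ c ∷ w) + (suc k + length δ))

LoneMax⇒RunShape : ∀ {t s π} → 2 ≤ s → T (inA t s π) → nextMax t π ≡ 0 → RunShape t s π
LoneMax⇒RunShape {t} {s} {π} 2≤s π∈A next≡0 with InA⇒Shape π (Equivalence.to (T-inA⇔InA π) π∈A)
... | shape {C} {u} {v} {y} refl sh refl refl with 2≤⇒≡suc (Shaped-2≤c sh (≤-pred 2≤s))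
...   | c , refl , 1≤c with run-split C v | ∈-splitFirst u (Shaped-c∈u sh 1≤c)
...     | k , δ , refl , headNot | u₁ , w , refl , c∉u₁ =
  runShape 1≤c c∉u₁ (Shaped-afterRun sh headNot) (Shaped-nextMax≡0 sh next≡0) sh (runWord≡ C (u₁ ++ c ∷ w) k δ y) refl
    (cong (λ l → suc (length (u₁ ++ c ∷ w) + suc l)) (trans (length-++ (replicate k C)) (cong (_+ length δ) (length-replicate k))))

LoneMax : ℕ → ℕ → ℕ → ℕ → List ℕ → Set
LoneMax t s r i π = ((T (inA t s π) × nextMax t π ≡ 0) × runAt s π ≡ r) × firstBelowSecond π ≡ i

LoneMax? : ∀ t s r i → Decidable (LoneMax t s r i)
LoneMax? t s r i = ((inA? t s ∩? (λ π → nextMax t π ≟ 0)) ∩? (λ π → runAt s π ≟ r)) ∩? (λ π → firstBelowSecond π ≟ i)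

removeRun-forward : ∀ {n t s r i π} → 2 ≤ s → π ∈ words n n → LoneMax t s r i π →
  (removeRun t s r π ∈ words (n ∸ r) (n ∸ r) × T (inA (t ∸ r) i (removeRun t s r π))) × insertRun t s r (removeRun t s r π) ≡ π
removeRun-forward {n} {t} {s} {r} {i} {π} 2≤s π∈ (((π∈A , next≡0) , runAt≡r) , third≡i)
  with LoneMax⇒RunShape {t} {s} {π} 2≤s π∈A next≡0
... | runShape 1≤c c∉u₁ c+1∉δ c+2∉y shπ refl refl refl with trans (sym runAt≡r) (M.runAt≡) | trans (sym third≡i) M.firstBelowSecond≡
  where module M = RunCorrespondence 1≤c c∉u₁ c+1∉δ c+2∉y shπ
...   | refl | refl = subst Goal (sym M.removeRun≡) ((M.σ∈words (proj₁ (∈-words⁻ {n} {n} π∈)) , M.σ∈A) , M.insertRun≡)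
  where
  module M = RunCorrespondence 1≤c c∉u₁ c+1∉δ c+2∉y shπ
  Goal : List ℕ → Set
  Goal σ = (σ ∈ words (n ∸ r) (n ∸ r) × T (inA (t ∸ r) i σ)) × insertRun t s r σ ≡ π

removeRun-backward : ∀ {n t s r i σ} → 2 ≤ s → 1 ≤ r → r ≤ t ∸ s → i ≤ s ∸ 1 → r ≤ n →
  σ ∈ words (n ∸ r) (n ∸ r) → T (inA (t ∸ r) i σ) →
  (insertRun t s r σ ∈ words n n × LoneMax t s r i (insertRun t s r σ)) × removeRun t s r (insertRun t s r σ) ≡ σ
removeRun-backward {n} {t} {suc s₁} {suc k} {i} {σ} 2≤s 1≤r r≤t∸s i≤s₁ r≤n σ∈ σ∈A
  with InA⇒Shape σ (Equivalence.to (T-inA⇔InA σ) σ∈A)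
... | shape {c} {u₁} {v₁} {y} refl shσ refl t∸r≡ with splitAt-length (s₁ ∸ suc (length u₁)) v₁ kw≤
  where
  kw≤ : s₁ ∸ suc (length u₁) ≤ length v₁
  kw≤ = subst (s₁ ∸ suc (length u₁) ≤_)
    (trans (cong (_∸ suc (length u₁)) (+-suc (length u₁) (length v₁))) (m+n∸m≡n (suc (length u₁)) (length v₁)))
    (∸-monoˡ-≤ (suc (length u₁)) (≤-pred (subst (suc s₁ ≤_) t∸r≡ (≤∸⇒≤∸ {t = t} 1≤r r≤t∸s))))
... | w , δ , refl , |w|≡ with t≡ | s≡
  where
  u = u₁ ++ c ∷ w
  |u|≡ : length u ≡ s₁
  |u|≡ = trans (length-++ u₁) (trans (+-suc (length u₁) (length w)) (trans (cong (λ l → suc (length u₁ + l)) |w|≡) (m+[n∸m]≡n i≤s₁)))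
  s≡ : suc s₁ ≡ suc (length u)
  s≡ = cong suc (sym |u|≡)
  t≡ : t ≡ suc (length u + (suc k + length δ))
  t≡ = begin
    t                                               ≡⟨ m∸n+n≡m (≤-trans r≤t∸s (m∸n≤m t (suc s₁))) ⟨
    t ∸ suc k + suc k                               ≡⟨ cong (_+ suc k) t∸r≡ ⟩
    suc (length u₁ + suc (length (w ++ δ))) + suc k ≡⟨ cong₂ (λ l l′ → suc (length u₁ + suc l) + l′) (length-++ w) refl ⟩
    suc (length u₁ + suc (length w + length δ)) + suc k ≡⟨ rearrange (length u₁) (length w) (length δ) k ⟩
    suc ((length u₁ + suc (length w)) + (suc k + length δ)) ≡⟨ cong (λ l → suc (l + (suc k + length δ))) (length-++ u₁) ⟨
    suc (length u + (suc k + length δ))             ∎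
    where
    open ≡-Reasoning
    rearrange : ∀ a b d k → suc (a + suc (b + d)) + suc k ≡ suc ((a + suc b) + (suc k + d))
    rearrange = solve-∀
... | refl | refl = subst Goal (sym σ≡) (subst Goal′ (sym M.insertRun≡)
                      ((π∈ , ((M.π∈A , M.nextMax≡0) , M.runAt≡) , M.firstBelowSecond≡) , M.removeRun≡))
  where
  open Shaped shσ using (1≤c; c∉u; c+1∉v)
  module M = RunCorrespondence {w = w} {k} {δ} 1≤c c∉u (c+1∉v ∘ ∈-++⁺ʳ w) (All≤⇒∉suc (Shaped-properties.y≤c+1 shσ))
                               (Shaped-raise {w = w} {k} {δ} shσ)
  Goal : List ℕ → Set
  Goal σ = (insertRun M.t M.s M.r σ ∈ words n n × LoneMax M.t M.s M.r i (insertRun M.t M.s M.r σ))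
           × removeRun M.t M.s M.r (insertRun M.t M.s M.r σ) ≡ σ
  Goal′ : List ℕ → Set
  Goal′ π = (π ∈ words n n × LoneMax M.t M.s M.r i π) × removeRun M.t M.s M.r π ≡ M.σ
  σ≡ : shapeWord c u₁ (w ++ δ) y ≡ M.σ
  σ≡ = shapeWord-++ c u₁ w δ y
  π∈ : M.π ∈ words n n
  π∈ = M.π∈words r≤n (trans (cong length (sym σ≡)) (proj₁ (∈-words⁻ {n ∸ suc k} {n ∸ suc k} σ∈)))

count-LoneMax : ∀ n t s r i → 2 ≤ s → 1 ≤ r → r ≤ t ∸ s → i ≤ s ∸ 1 → r ≤ n →
  count (LoneMax? t s r i) (words n n) ≡ a (n ∸ r) (t ∸ r) i
count-LoneMax n t s r i 2≤s 1≤r r≤t∸s i≤s∸1 r≤n =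
  count-bijection (LoneMax? t s r i) (inA? (t ∸ r) i) (words-unique n n) (words-unique (n ∸ r) (n ∸ r))
    (removeRun t s r) (insertRun t s r) (removeRun-forward {n} 2≤s) (removeRun-backward 2≤s 1≤r r≤t∸s i≤s∸1 r≤n)

LoneMax-bounds : ∀ {t s π} → 2 ≤ s → T (inA t s π) → nextMax t π ≡ 0 →
  (1 ≤ runAt s π × runAt s π ≤ t ∸ s) × (1 ≤ firstBelowSecond π × firstBelowSecond π ≤ s ∸ 1)
LoneMax-bounds {t} {s} {π} 2≤s π∈A next≡0 with LoneMax⇒RunShape {t} {s} {π} 2≤s π∈A next≡0
... | runShape {c} {k} {u₁} {w} {δ} 1≤c c∉u₁ c+1∉δ c+2∉y shπ refl refl refl =
  (subst (1 ≤_) (sym M.runAt≡) (s≤s z≤n) , subst₂ _≤_ (sym M.runAt≡) (sym t∸s≡) (m≤m+n (suc k) (length δ)))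
  , (subst (1 ≤_) (sym M.firstBelowSecond≡) (s≤s z≤n) , subst₂ _≤_ (sym M.firstBelowSecond≡) (sym (length-++ u₁)) (m<m+n (length u₁) (s≤s z≤n)))
  where
  module M = RunCorrespondence 1≤c c∉u₁ c+1∉δ c+2∉y shπ
  t∸s≡ : M.t ∸ M.s ≡ suc k + length δ
  t∸s≡ = m+n∸m≡n (length M.u) (suc k + length δ)

count-lone : ∀ n t s → 2 ≤ s → t ≤ n →
  count (inA? t s ∩? (λ π → nextMax t π ≟ 0)) (words n n) ≡ sumFT 1 (t ∸ s) (λ r → sumFT 1 (s ∸ 1) (λ i → a (n ∸ r) (t ∸ r) i))
count-lone n t s 2≤s t≤n = trans (count-partition (inA? t s ∩? lone?) (runAt s) 1 (t ∸ s) (words n n) runAt-bounds)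
  (sumFT-cong 1 (t ∸ s) λ r 1≤r r≤t∸s →
    trans (count-partition ((inA? t s ∩? lone?) ∩? (λ π → runAt s π ≟ r)) firstBelowSecond 1 (s ∸ 1) (words n n) firstBelowSecond-bounds)
      (sumFT-cong 1 (s ∸ 1) λ i _ i≤s∸1 → count-LoneMax n t s r i 2≤s 1≤r r≤t∸s i≤s∸1 (≤-trans r≤t∸s (≤-trans (m∸n≤m t s) t≤n))))
  where
  lone? : Decidable (λ π → nextMax t π ≡ 0)
  lone? π = nextMax t π ≟ 0
  runAt-bounds : ∀ {π} → π ∈ words n n → T (inA t s π) × nextMax t π ≡ 0 → 1 ≤ runAt s π × runAt s π ≤ t ∸ s
  runAt-bounds {π} _ (π∈A , next≡0) = proj₁ (LoneMax-bounds {t} {s} {π} 2≤s π∈A next≡0)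
  firstBelowSecond-bounds : ∀ {π r} → π ∈ words n n → (T (inA t s π) × nextMax t π ≡ 0) × runAt s π ≡ r →
    1 ≤ firstBelowSecond π × firstBelowSecond π ≤ s ∸ 1
  firstBelowSecond-bounds {π} _ ((π∈A , next≡0) , _) = proj₂ (LoneMax-bounds {t} {s} {π} 2≤s π∈A next≡0)

a-recurrence : ∀ n t s → 2 ≤ s → s < t → t ≤ n →
  a n t s ≡ sumFT t (n ∸ 1) (λ j → a (n ∸ 1) j s) + sumFT 1 (t ∸ s) (λ r → sumFT 1 (s ∸ 1) (λ i → a (n ∸ r) (t ∸ r) i))
a-recurrence n t s 2≤s s<t t≤n = trans (count-split (inA? t s) (λ π → nextMax t π ≟ 0) (words n n))
  (cong₂ _+_ (count-recurring n t s s<t t≤n) (count-lone n t s 2≤s t≤n))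

lemma4 : ((n t s : ℕ) → a n t s ≢ 0 → (2 ≤ n) × (1 ≤ s) × (s < t) × (t ≤ n))
       × ((n t s : ℕ) → 3 ≤ n → 2 ≤ s → s < t → t ≤ n →
            a n t s ≡ sumFT t (n ∸ 1) (λ j → a (n ∸ 1) j s)
                      + sumFT 1 (t ∸ s) (λ r → sumFT 1 (s ∸ 1) (λ i → a (n ∸ r) (t ∸ r) i)))
       × ((n t : ℕ) → 2 ≤ n → 2 ≤ t → t ≤ n → a n t 1 ≡ 2 ^ (n ∸ t))
-- The hypotheses 3 ≤ n and 2 ≤ n are implied by 2 ≤ s < t ≤ n and 2 ≤ t ≤ n.
lemma4 = a-support , (λ n t s _ → a-recurrence n t s) , (λ n t _ → a-secondAt1 n t)
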